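{- Let $Q$ be a strongly-connected quiver or strongly-connected starred quiver. Then the root polytope $\mathrm{Root}(Q)$ is reflexive and terminal: the polar dual of $\mathrm{Root}(Q)$ is a lattice polytope, and the only lattice points of $\mathrm{Root}(Q)$ are the origin (which lies in its relative interior) and its vertices.
   Context: A quiver $Q$ has normal vertices $\mathcal V_\bullet=\{v_1,\dots,v_n\}$ ($n\ge 1$), a possibly empty set of starred vertices $\mathcal V_\star=\{\star_1,\dots,\star_\ell\}$, and a set of arrows $\mathrm{Arr}(Q)$, each going from a normal vertex to a normal vertex, from a normal vertex to a starred vertex, or from a starred vertex to a normal vertex (never between two starred vertices); there are no loops and no repeated arrows, and the underlying undirected graph is connected. If $\ell>0$, $Q$ is called a starred quiver. For each arrow $a$ define $u_a\in\mathbb R^n$ (with $e_1,\dots,e_n$ the standard basis): $u_a=e_j-e_i$ if $a:v_i\to v_j$; $u_a=e_j$ if $a:\star_k\to v_j$; $u_a=-e_i$ if $a:v_i\to\star_k$. The root polytope is $\mathrm{Root}(Q)=\mathrm{Conv}\{u_a : a\in \mathrm{Arr}(Q)\}\subset\mathbb R^n$. Let $\overline Q$ be the quiver obtained by identifying all starred vertices of $Q$ into a single starred vertex (removing duplicate arrows); $Q$ is strongly-connected if $\overline Q$ (which is $Q$ itself if there are no starred vertices) has an oriented path from any vertex to any other vertex. The polar dual of a full-dimensional polytope $\mathbf P\subset\mathbb R^n$ containing the origin in its interior is $\mathbf P^*=\{y : x\cdot y\ge -1 \text{ for all } x\in\mathbf P\}$. A full-dimensional lattice polytope is reflexive if its polar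 dual is a lattice polytope. Two lattice polytopes $\mathbf P_1\subset\mathbb R^n$, $\mathbf P_2\subset\mathbb R^m$ are integrally equivalent if there is an affine map restricting to a bijection $\mathbf P_1\to\mathbf P_2$ and to a bijection between $\mathbb Z^n\cap\mathrm{aff}(\mathbf P_1)$ and $\mathbb Z^m\cap\mathrm{aff}(\mathbf P_2)$; the word reflexive is also used for any polytope integrally equivalent to a reflexive polytope (this is relevant when $Q$ has no starred vertices, in which case $\mathrm{Root}(Q)$ lies in the hyperplane $x_1+\dots+x_n=0$). A lattice polytope is terminal if the origin lies in its (relative) interior and the origin and the vertices are its only lattice points.
   Formalization: The root polytope, its polar dual and their vertices are taken inside ℚ^n rather than $\mathbb R^n$, with rational coefficients in convex combinations. -}

module Defs where

open import Data.Nat using (ℕ; zero; suc; NonZero)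
open import Data.Fin using (Fin; _≟_)
open import Data.Integer using (ℤ)
open import Data.Rational using (ℚ; 0ℚ; 1ℚ; _+_; _*_; _-_; -_; _≤_; _<_; _/_)
open import Data.List using (List; []; _∷_; map)
open import Data.List.Membership.Propositional using (_∈_)
open import Data.List.Relation.Unary.All using (All)
open import Data.List.Relation.Unary.Unique.Propositional using (Unique)
open import Data.Product using (Σ; ∃; _×_; _,_; proj₁; proj₂)
open import Data.Sum using (_⊎_; inj₁; inj₂)
open import Data.Unit using (⊤; tt)
open import Relation.Nullary using (¬_; yes; no)
open import Relation.Binary.PropositionalEquality using (_≡_; _≢_)
open import Relation.Binary.Construct.Closure.ReflexiveTransitive using (Star)

-- Quivers with n normal vertices (Fin n) and ℓ starred vertices (Fin ℓ)

data Arrow (n ℓ : ℕ) : Set where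
  nn : Fin n → Fin n → Arrow n ℓ
  ns : Fin n → Fin ℓ → Arrow n ℓ
  sn : Fin ℓ → Fin n → Arrow n ℓ

Vertex : ℕ → ℕ → Set
Vertex n ℓ = Fin n ⊎ Fin ℓ

source : ∀ {n ℓ} → Arrow n ℓ → Vertex n ℓ
source (nn i j) = inj₁ i
source (ns i k) = inj₁ i
source (sn k j) = inj₂ k

target : ∀ {n ℓ} → Arrow n ℓ → Vertex n ℓ
target (nn i j) = inj₁ j
target (ns i k) = inj₂ k
target (sn k j) = inj₁ j

NoLoop : ∀ {n ℓ} → Arrow n ℓ → Set
NoLoop (nn i j) = i ≢ j
NoLoop (ns i k) = ⊤
NoLoop (sn k j) = ⊤

Adjacent : ∀ {n ℓ} → List (Arrow n ℓ) → Vertex n ℓ → Vertex n ℓ → Set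
Adjacent arr x y =
  ∃ λ a → a ∈ arr × ((source a ≡ x × target a ≡ y) ⊎ (source a ≡ y × target a ≡ x))

record IsQuiver (n ℓ : ℕ) (arr : List (Arrow n ℓ)) : Set where
  field
    noLoops    : All NoLoop arr
    noRepeats  : Unique arr
    connected  : ∀ (x y : Vertex n ℓ) → Star (Adjacent arr) x y

-- Q̄ : all starred vertices identified into a single starred vertex tt
collapse : ∀ {n ℓ} → Vertex n ℓ → Fin n ⊎ ⊤
collapse (inj₁ i) = inj₁ i
collapse (inj₂ k) = inj₂ tt

-- arrows of Q̄ (duplicates are irrelevant for reachability)
EdgeQbar : ∀ {n ℓ} → List (Arrow n ℓ) → Fin n ⊎ ⊤ → Fin n ⊎ ⊤ → Set
EdgeQbar arr x y =
  ∃ λ a → a ∈ arr × (collapse (source a) ≡ x × collapse (target a) ≡ y)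

StronglyConnected : ∀ {n ℓ} → List (Arrow n ℓ) → Set
StronglyConnected {n} {ℓ} arr =
  ∀ (x y : Vertex n ℓ) → Star (EdgeQbar arr) (collapse x) (collapse y)

Vecℚ : ℕ → Set
Vecℚ n = Fin n → ℚ

_≐_ : ∀ {n} → Vecℚ n → Vecℚ n → Set
x ≐ y = ∀ i → x i ≡ y i

zeroV : ∀ {n} → Vecℚ n
zeroV _ = 0ℚ

onesV : ∀ {n} → Vecℚ n
onesV _ = 1ℚ

_+ᵥ_ : ∀ {n} → Vecℚ n → Vecℚ n → Vecℚ n
(x +ᵥ y) i = x i + y i

_·ᵥ_ : ∀ {n} → ℚ → Vecℚ n → Vecℚ n
(c ·ᵥ x) i = c * x i

sumFin : ∀ {n} → (Fin n → ℚ) → ℚ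
sumFin {zero}  f = 0ℚ
sumFin {suc n} f = f Fin.zero + sumFin {n} (λ i → f (Fin.suc i))

dot : ∀ {n} → Vecℚ n → Vecℚ n → ℚ
dot x y = sumFin (λ i → x i * y i)

basis : ∀ {n} → Fin n → Vecℚ n
basis i k with i ≟ k
... | yes _ = 1ℚ
... | no  _ = 0ℚ

embed : ∀ {n} → (Fin n → ℤ) → Vecℚ n
embed z i = z i / 1

sumCoeffs : ∀ {n} → List (ℚ × Vecℚ n) → ℚ
sumCoeffs []             = 0ℚ
sumCoeffs ((c , _) ∷ cs) = c + sumCoeffs cs

combo : ∀ {n} → List (ℚ × Vecℚ n) → Vecℚ n
combo []             = zeroV
combo ((c , v) ∷ cs) = (c ·ᵥ v) +ᵥ combo cs

InConv : ∀ {n} → List (Vecℚ n) → Vecℚ n → Set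
InConv {n} vs x =
  ∃ λ (cs : List (ℚ × Vecℚ n)) →
    All (λ p → (0ℚ ≤ proj₁ p) × (proj₂ p ∈ vs)) cs
    × sumCoeffs cs ≡ 1ℚ
    × (combo cs ≐ x)

IsVertex : ∀ {n} → (Vecℚ n → Set) → Vecℚ n → Set
IsVertex {n} P x =
  P x × (∀ (p q : Vecℚ n) (t : ℚ) → P p → P q → 0ℚ < t → t < 1ℚ →
          ((t ·ᵥ p) +ᵥ ((1ℚ - t) ·ᵥ q)) ≐ x → p ≐ q)

rootVec : ∀ {n ℓ} → Arrow n ℓ → Vecℚ n
rootVec (nn i j) k = basis j k - basis i k
rootVec (ns i _) k = - basis i k
rootVec (sn _ j) k = basis j k

Root : ∀ {n ℓ} → List (Arrow n ℓ) → Vecℚ n → Set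
Root arr = InConv (map rootVec arr)

PolarDual : ∀ {n} → (Vecℚ n → Set) → Vecℚ n → Set
PolarDual P y = ∀ x → P x → - 1ℚ ≤ dot x y

-- the linear span of Root(Q): ℚⁿ if ℓ > 0, the hyperplane Σ xᵢ = 0 if ℓ = 0
InSpan : ∀ {n} (ℓ : ℕ) → Vecℚ n → Set
InSpan zero    d = sumFin d ≡ 0ℚ
InSpan (suc ℓ) d = ⊤

-- the origin lies in the (relative) interior of P, relative to the ambient
-- space L = InSpan ℓ : P ⊆ L, and P contains a neighbourhood of 0 in L
OriginInRelInt : ∀ {n} (ℓ : ℕ) → (Vecℚ n → Set) → Set
OriginInRelInt {n} ℓ P =
  (∀ x → P x → InSpan ℓ x) ×
  (∀ (d : Vecℚ n) → InSpan ℓ d → ∃ λ (ε : ℚ) → (0ℚ < ε) × P (ε ·ᵥ d))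

-- the polar dual (in L, with dual lattice ℤⁿ if ℓ > 0 and ℤⁿ/ℤ·(1,…,1) if
-- ℓ = 0) is a lattice polytope: it is the convex hull of finitely many
-- lattice points (modulo the line ℚ·(1,…,1) when ℓ = 0)
DualIsLattice : ∀ {n} (ℓ : ℕ) → (Vecℚ n → Set) → Set
DualIsLattice {n} zero P =
  ∃ λ (V : List (Fin n → ℤ)) → ∀ (y : Vecℚ n) →
    (PolarDual P y →
       ∃ λ w → ∃ λ (t : ℚ) → InConv (map embed V) w × (y ≐ (w +ᵥ (t ·ᵥ onesV))))
    × (∀ w (t : ℚ) → InConv (map embed V) w →
       y ≐ (w +ᵥ (t ·ᵥ onesV)) → PolarDual P y)
DualIsLattice {n} (suc ℓ) P =
  ∃ λ (V : List (Fin n → ℤ)) → ∀ (y : Vecℚ n) →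
    (PolarDual P y → InConv (map embed V) y)
    × (InConv (map embed V) y → PolarDual P y)

OnlyLatticePointsOriginAndVertices : ∀ {n} → (Vecℚ n → Set) → Set
OnlyLatticePointsOriginAndVertices {n} P =
  ∀ (z : Fin n → ℤ) → P (embed z) → (embed z ≐ zeroV) ⊎ IsVertex P (embed z)

-- For a functional y write ȳ for its potential on the vertices of Q̄ (ȳ(⋆) = 0), so that
-- ⟨u_a, y⟩ = ȳ(t) − ȳ(s) for an arrow a : s → t.
--
-- Interior: by strong connectivity every e_i − e_b (b a base vertex) and its negative are sums of
-- roots along paths, so the cone of the roots is the whole span; an arrow followed by a path back
-- represents 0 with positive weight, so small multiples of the span lie in Root(Q).
--
-- Dual: Root(Q)* = {y : ȳ(s) ≤ ȳ(t) + 1 for every arrow s → t}. Normalised by ȳ(b) = 0, its lattice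
-- points are bounded by path lengths, hence finitely many; and if N y is integral then
-- y = (1/N) Σ_{k<N} ⌊(N y + k)/N⌋ (Hermite's identity) is an average of such lattice points.
--
-- Terminal: a lattice point z of Root(Q) has coordinates in {−1, 0, 1}. Let X be a normal vertex
-- with z_X = 1 and Y one with z_Y = −1, either being the starred vertex if there is none. The
-- functional with potential [· = X] − [· = Y] is at most 2 on Root(Q), with equality only at
-- e_X − e_Y, and it is 2 at z; so z is a vertex, or z = 0 when X = Y = ⋆.

{-# OPTIONS --safe #-}
module Submission where

open import Defs
open import Data.Nat as ℕ using (ℕ; zero; suc; z≤n; s≤s)
import Data.Nat.Properties as ℕ
import Data.Nat.DivMod as ℕ
open import Data.Integer as ℤ using (ℤ; +_; -[1+_]; +≤+; -≤-)
import Data.Integer.Properties as ℤ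
open import Data.Integer.DivMod using (_/ℕ_; _%ℕ_; a≡a%ℕn+[a/ℕn]*n; [n/ℕd]*d≤n; n<s[n/ℕd]*d)
open import Data.Integer.Tactic.RingSolver using (solve-∀)
open import Data.Fin as Fin using (Fin; zero; suc; toℕ)
import Data.Fin.Properties as Fin
open import Data.Rational
open import Data.Rational.Properties
import Data.Rational.Unnormalised as ℚᵘ
import Data.Rational.Unnormalised.Properties as ℚᵘ
open import Data.Rational.Solver
open import Data.List using (List; []; _∷_; map; _++_; filter; tabulate; cartesianProductWith; upTo)
open import Data.List.Membership.Propositional using (_∈_)
open import Data.List.Membership.Propositional.Properties
  using (∈-map⁺; ∈-map⁻; ∈-filter⁺; ∈-filter⁻; ∈-++⁺ˡ; ∈-++⁺ʳ; ∈-upTo⁺; ∈-cartesianProductWith⁺)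
open import Data.List.Relation.Unary.All as All using (All; []; _∷_)
import Data.List.Relation.Unary.All.Properties as All
open import Data.List.Relation.Unary.Any using (here)
open import Data.Product using (∃; _×_; _,_; proj₁; proj₂)
open import Data.Sum using (_⊎_; inj₁; inj₂)
import Data.Sum.Properties as Sum
open import Data.Unit using (⊤; tt)
import Data.Unit.Properties as Unit
open import Data.Empty using (⊥-elim)
import Data.Vec.Functional as Vector
open import Function using (_∘_)
open import Relation.Nullary using (¬_; Dec; yes; no)
open import Relation.Nullary.Decidable using (_×-dec_)
open import Relation.Binary.PropositionalEquality
open import Relation.Binary.Construct.Closure.ReflexiveTransitive using (Star; ε; _◅_)

open +-*-Solver

private
  variable
    n ℓ : ℕ

-- Integers inside ℚ

ι : ℤ → ℚ
ι z = z / 1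

private
  ιᵘ : ℤ → ℚᵘ.ℚᵘ
  ιᵘ z = ℚᵘ.mkℚᵘ z 0

  toℚᵘ-ι : ∀ z → toℚᵘ (ι z) ℚᵘ.≃ ιᵘ z
  toℚᵘ-ι z = toℚᵘ-fromℚᵘ (ιᵘ z)

ι-+ : ∀ a b → ι (a ℤ.+ b) ≡ ι a + ι b
ι-+ a b = toℚᵘ-injective (begin-equality
  toℚᵘ (ι (a ℤ.+ b))        ≃⟨ toℚᵘ-ι (a ℤ.+ b) ⟩
  ιᵘ (a ℤ.+ b)               ≃⟨ ℚᵘ.*≡* (cong (ℤ._* + 1) (sym (cong₂ ℤ._+_ (ℤ.*-identityʳ a) (ℤ.*-identityʳ b)))) ⟩
  ιᵘ a ℚᵘ.+ ιᵘ b             ≃⟨ ℚᵘ.+-cong (toℚᵘ-ι a) (toℚᵘ-ι b) ⟨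
  toℚᵘ (ι a) ℚᵘ.+ toℚᵘ (ι b) ≃⟨ toℚᵘ-homo-+ (ι a) (ι b) ⟨
  toℚᵘ (ι a + ι b)           ∎)
  where open ℚᵘ.≤-Reasoning

ι-* : ∀ a b → ι (a ℤ.* b) ≡ ι a * ι b
ι-* a b = toℚᵘ-injective (begin-equality
  toℚᵘ (ι (a ℤ.* b))        ≃⟨ toℚᵘ-ι (a ℤ.* b) ⟩
  ιᵘ (a ℤ.* b)               ≃⟨ ℚᵘ.*≡* refl ⟩
  ιᵘ a ℚᵘ.* ιᵘ b             ≃⟨ ℚᵘ.*-cong (toℚᵘ-ι a) (toℚᵘ-ι b) ⟨
  toℚᵘ (ι a) ℚᵘ.* toℚᵘ (ι b) ≃⟨ toℚᵘ-homo-* (ι a) (ι b) ⟨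
  toℚᵘ (ι a * ι b)           ∎)
  where open ℚᵘ.≤-Reasoning

ι-mono-≤ : ∀ {a b} → a ℤ.≤ b → ι a ≤ ι b
ι-mono-≤ {a} {b} a≤b = toℚᵘ-cancel-≤ (begin
  toℚᵘ (ι a) ≃⟨ toℚᵘ-ι a ⟩
  ιᵘ a       ≤⟨ ℚᵘ.*≤* (ℤ.*-monoʳ-≤-nonNeg (+ 1) a≤b) ⟩
  ιᵘ b       ≃⟨ toℚᵘ-ι b ⟨
  toℚᵘ (ι b) ∎)
  where open ℚᵘ.≤-Reasoning

ι-cancel-≤ : ∀ {a b} → ι a ≤ ι b → a ℤ.≤ b
ι-cancel-≤ {a} {b} ιa≤ιb = ℤ.*-cancelʳ-≤-pos a b (+ 1) (ℚᵘ.drop-*≤* (begin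
  ιᵘ a       ≃⟨ toℚᵘ-ι a ⟨
  toℚᵘ (ι a) ≤⟨ toℚᵘ-mono-≤ ιa≤ιb ⟩
  toℚᵘ (ι b) ≃⟨ toℚᵘ-ι b ⟩
  ιᵘ b       ∎))
  where open ℚᵘ.≤-Reasoning

ι-injective : ∀ {a b} → ι a ≡ ι b → a ≡ b
ι-injective eq = ℤ.≤-antisym (ι-cancel-≤ (≤-reflexive eq)) (ι-cancel-≤ (≤-reflexive (sym eq)))

ι[1+m]*1/[1+m] : ∀ m → ι (+ suc m) * (+ 1 / suc m) ≡ 1ℚ
ι[1+m]*1/[1+m] m = toℚᵘ-injective (begin-equality
  toℚᵘ (ι (+ suc m) * (+ 1 / suc m))               ≃⟨ toℚᵘ-homo-* (ι (+ suc m)) (+ 1 / suc m) ⟩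
  toℚᵘ (ι (+ suc m)) ℚᵘ.* toℚᵘ (+ 1 / suc m)       ≃⟨ ℚᵘ.*-cong (toℚᵘ-ι (+ suc m)) (toℚᵘ-fromℚᵘ (ℚᵘ.mkℚᵘ (+ 1) m)) ⟩
  ιᵘ (+ suc m) ℚᵘ.* ℚᵘ.mkℚᵘ (+ 1) m                ≃⟨ ℚᵘ.*≡* (trans (ℤ.*-identityʳ (+ suc m ℤ.* + 1)) (trans (ℤ.*-identityʳ (+ suc m))
                                                       (sym (trans (ℤ.*-identityˡ _) (cong +_ (ℕ.*-identityˡ (suc m))))))) ⟩
  ιᵘ (+ 1)                                           ≃⟨ toℚᵘ-ι (+ 1) ⟨
  toℚᵘ 1ℚ                                            ∎)
  where open ℚᵘ.≤-Reasoning

0<1 : 0ℚ < 1ℚ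
0<1 = positive⁻¹ 1ℚ

p≤q⇒0≤q-p : ∀ {p q} → p ≤ q → 0ℚ ≤ q - p
p≤q⇒0≤q-p {p} {q} p≤q = subst (_≤ q - p) (+-inverseʳ p) (+-monoˡ-≤ (- p) p≤q)

0≤q-p⇒p≤q : ∀ {p q} → 0ℚ ≤ q - p → p ≤ q
0≤q-p⇒p≤q {p} {q} 0≤q-p = subst₂ _≤_ (+-identityˡ p) (solve 2 (λ p q → q :- p :+ p := q) refl p q)
  (+-monoˡ-≤ p 0≤q-p)

0≤p*q : ∀ {p q} → 0ℚ ≤ p → 0ℚ ≤ q → 0ℚ ≤ p * q
0≤p*q {p} {q} 0≤p 0≤q = subst (_≤ p * q) (*-zeroʳ p) (*-monoˡ-≤-nonNeg p {{nonNegative 0≤p}} 0≤q)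

*-monoˡ-≤-0≤ : ∀ {c a b} → 0ℚ ≤ c → a ≤ b → c * a ≤ c * b
*-monoˡ-≤-0≤ {c} 0≤c = *-monoˡ-≤-nonNeg c {{nonNegative 0≤c}}

+-squeezeˡ : ∀ {a b A B} → b ≤ B → A + B ≤ a + b → A ≤ a
+-squeezeˡ {a} {b} {A} {B} b≤B A+B≤a+b = subst₂ _≤_
  (solve 2 (λ A B → A :+ B :- B := A) refl A B) (solve 2 (λ a B → a :+ B :- B := a) refl a B)
  (+-monoˡ-≤ (- B) (≤-trans A+B≤a+b (+-monoʳ-≤ a b≤B)))

+-squeezeʳ : ∀ {a b A B} → a ≤ A → A + B ≤ a + b → B ≤ b
+-squeezeʳ {a} {b} {A} {B} a≤A A+B≤a+b =
  +-squeezeˡ a≤A (subst₂ _≤_ (+-comm A B) (+-comm a b) A+B≤a+b)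

p<q⇒0<q-p : ∀ {p q} → p < q → 0ℚ < q - p
p<q⇒0<q-p {p} {q} p<q = subst (_< q - p) (+-inverseʳ p) (+-monoˡ-< (- p) p<q)

convex-≥ : ∀ {t a b M} → 0ℚ < t → 0ℚ ≤ 1ℚ - t → M ≤ t * a + (1ℚ - t) * b → b ≤ M → M ≤ a
convex-≥ {t} {a} {b} {M} 0<t 0≤1-t M≤mix b≤M = *-cancelˡ-≤-pos t {{positive 0<t}} (0≤q-p⇒p≤q
  (subst (0ℚ ≤_) (solve 4 (λ t a b M → (t :* a :+ (con 1ℚ :- t) :* b :- M) :+ (con 1ℚ :- t) :* (M :- b) := t :* a :- t :* M) refl t a b M)
    (+-mono-≤ (p≤q⇒0≤q-p M≤mix) (0≤p*q 0≤1-t (p≤q⇒0≤q-p b≤M)))))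

-- Finite sums and dot products

sumFin-cong : ∀ {f g : Fin n → ℚ} → (∀ i → f i ≡ g i) → sumFin f ≡ sumFin g
sumFin-cong {zero}  f≗g = refl
sumFin-cong {suc n} f≗g = cong₂ _+_ (f≗g zero) (sumFin-cong (f≗g ∘ suc))

sumFin-+ : ∀ (f g : Fin n → ℚ) → sumFin (λ i → f i + g i) ≡ sumFin f + sumFin g
sumFin-+ {zero}  f g = refl
sumFin-+ {suc n} f g = begin
  f zero + g zero + sumFin (λ i → f (suc i) + g (suc i))
    ≡⟨ cong (_+_ (f zero + g zero)) (sumFin-+ (f ∘ suc) (g ∘ suc)) ⟩
  f zero + g zero + (sumFin (f ∘ suc) + sumFin (g ∘ suc))
    ≡⟨ solve 4 (λ a b c d → a :+ b :+ (c :+ d) := a :+ c :+ (b :+ d)) refl (f zero) (g zero) _ _ ⟩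
  f zero + sumFin (f ∘ suc) + (g zero + sumFin (g ∘ suc)) ∎
  where open ≡-Reasoning

sumFin-* : ∀ c (f : Fin n → ℚ) → sumFin (λ i → c * f i) ≡ c * sumFin f
sumFin-* {zero}  c f = sym (*-zeroʳ c)
sumFin-* {suc n} c f = trans (cong (_+_ (c * f zero)) (sumFin-* c (f ∘ suc)))
  (sym (*-distribˡ-+ c (f zero) _))

sumFin-const : ∀ n c → sumFin {n} (λ _ → c) ≡ ι (+ n) * c
sumFin-const zero    c = sym (*-zeroˡ c)
sumFin-const (suc n) c = begin
  c + sumFin {n} (λ _ → c)  ≡⟨ cong (_+_ c) (sumFin-const n c) ⟩
  c + ι (+ n) * c           ≡⟨ solve 2 (λ c m → c :+ m :* c := (con 1ℚ :+ m) :* c) refl c (ι (+ n)) ⟩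
  (1ℚ + ι (+ n)) * c        ≡⟨ cong (_* c) (ι-+ (+ 1) (+ n)) ⟨
  ι (+ suc n) * c           ∎
  where open ≡-Reasoning

sumFin-zero : sumFin {n} (λ _ → 0ℚ) ≡ 0ℚ
sumFin-zero {n} = trans (sumFin-const n 0ℚ) (*-zeroʳ (ι (+ n)))

sumFin-last : ∀ (f : Fin (suc n) → ℚ) → sumFin f ≡ sumFin (f ∘ Fin.inject₁) + f (Fin.fromℕ n)
sumFin-last {zero}  f = trans (+-identityʳ (f zero)) (sym (+-identityˡ (f zero)))
sumFin-last {suc n} f = trans (cong (_+_ (f zero)) (sumFin-last (f ∘ suc)))
  (sym (+-assoc (f zero) _ _))

sumFin-nonNeg : ∀ {f : Fin n → ℚ} → (∀ i → 0ℚ ≤ f i) → 0ℚ ≤ sumFin f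
sumFin-nonNeg {zero}  f≥0 = ≤-refl
sumFin-nonNeg {suc n} f≥0 = +-mono-≤ (f≥0 zero) (sumFin-nonNeg (f≥0 ∘ suc))

sumFin-nonPos : ∀ {f : Fin n → ℚ} → (∀ i → f i ≤ 0ℚ) → sumFin f ≤ 0ℚ
sumFin-nonPos {zero}  f≤0 = ≤-refl
sumFin-nonPos {suc n} f≤0 = +-mono-≤ (f≤0 zero) (sumFin-nonPos (f≤0 ∘ suc))

sumFin-≥-term : ∀ {f : Fin n → ℚ} → (∀ i → 0ℚ ≤ f i) → ∀ j → f j ≤ sumFin f
sumFin-≥-term {suc n} {f} f≥0 zero =
  subst (_≤ sumFin f) (+-identityʳ (f zero)) (+-monoʳ-≤ (f zero) (sumFin-nonNeg (f≥0 ∘ suc)))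
sumFin-≥-term {suc n} {f} f≥0 (suc j) =
  subst (_≤ sumFin f) (+-identityˡ (f (suc j))) (+-mono-≤ (f≥0 zero) (sumFin-≥-term (f≥0 ∘ suc) j))

sumFin-≤-term : ∀ {f : Fin n → ℚ} → (∀ i → f i ≤ 0ℚ) → ∀ j → sumFin f ≤ f j
sumFin-≤-term {suc n} {f} f≤0 zero =
  subst (sumFin f ≤_) (+-identityʳ (f zero)) (+-monoʳ-≤ (f zero) (sumFin-nonPos (f≤0 ∘ suc)))
sumFin-≤-term {suc n} {f} f≤0 (suc j) =
  subst (sumFin f ≤_) (+-identityˡ (f (suc j))) (+-mono-≤ (f≤0 zero) (sumFin-≤-term (f≤0 ∘ suc) j))

basis-diag : ∀ (j : Fin n) → basis j j ≡ 1ℚ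
basis-diag j with j Fin.≟ j
... | yes _  = refl
... | no j≢j = ⊥-elim (j≢j refl)

basis-offdiag : ∀ {j k : Fin n} → j ≢ k → basis j k ≡ 0ℚ
basis-offdiag {j = j} {k} j≢k with j Fin.≟ k
... | yes j≡k = ⊥-elim (j≢k j≡k)
... | no _    = refl

basis-suc : ∀ (j k : Fin n) → basis (suc j) (suc k) ≡ basis j k
basis-suc j k with j Fin.≟ k
... | yes _ = refl
... | no _  = refl

basis-comm : ∀ (j k : Fin n) → basis j k ≡ basis k j
basis-comm j k with j Fin.≟ k | k Fin.≟ j
... | yes _   | yes _   = refl
... | no _    | no _    = refl
... | yes j≡k | no k≢j  = ⊥-elim (k≢j (sym j≡k))
... | no j≢k  | yes k≡j = ⊥-elim (j≢k (sym k≡j))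

basis-nonNeg : ∀ (j k : Fin n) → 0ℚ ≤ basis j k
basis-nonNeg j k with j Fin.≟ k
... | yes _ = <⇒≤ 0<1
... | no _  = ≤-refl

basis-≤1 : ∀ (j k : Fin n) → basis j k ≤ 1ℚ
basis-≤1 j k with j Fin.≟ k
... | yes _ = ≤-refl
... | no _  = <⇒≤ 0<1

sumFin-basis : ∀ (j : Fin n) (f : Fin n → ℚ) → sumFin (λ k → basis j k * f k) ≡ f j
sumFin-basis {suc n} zero f = begin
  basis {suc n} zero zero * f zero + sumFin (λ k → basis zero (suc k) * f (suc k))
    ≡⟨ cong₂ _+_ (cong (_* f zero) (basis-diag {suc n} zero))
         (sumFin-cong (λ k → cong (_* f (suc k)) (basis-offdiag {j = zero} {suc k} λ ()))) ⟩
  1ℚ * f zero + sumFin {n} (λ k → 0ℚ * f (suc k))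
    ≡⟨ cong₂ _+_ (*-identityˡ (f zero)) (trans (sumFin-cong (λ k → *-zeroˡ (f (suc k)))) (sumFin-zero {n})) ⟩
  f zero + 0ℚ ≡⟨ +-identityʳ (f zero) ⟩
  f zero ∎
  where open ≡-Reasoning
sumFin-basis {suc n} (suc j) f = begin
  basis (suc j) zero * f zero + sumFin (λ k → basis (suc j) (suc k) * f (suc k))
    ≡⟨ cong₂ _+_ (cong (_* f zero) (basis-offdiag {j = suc j} {zero} λ ()))
         (sumFin-cong (λ k → cong (_* f (suc k)) (basis-suc j k))) ⟩
  0ℚ * f zero + sumFin (λ k → basis j k * f (suc k))
    ≡⟨ cong₂ _+_ (*-zeroˡ (f zero)) (sumFin-basis j (f ∘ suc)) ⟩
  0ℚ + f (suc j) ≡⟨ +-identityˡ (f (suc j)) ⟩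
  f (suc j) ∎
  where open ≡-Reasoning

dot-comm : ∀ (x y : Vecℚ n) → dot x y ≡ dot y x
dot-comm x y = sumFin-cong (λ i → *-comm (x i) (y i))

dot-congˡ : ∀ {x x' : Vecℚ n} (y : Vecℚ n) → x ≐ x' → dot x y ≡ dot x' y
dot-congˡ y x≐x' = sumFin-cong (λ i → cong (_* y i) (x≐x' i))

dot-congʳ : ∀ (x : Vecℚ n) {y y' : Vecℚ n} → y ≐ y' → dot x y ≡ dot x y'
dot-congʳ x y≐y' = sumFin-cong (λ i → cong (x i *_) (y≐y' i))

dot-basisˡ : ∀ (j : Fin n) (y : Vecℚ n) → dot (basis j) y ≡ y j
dot-basisˡ = sumFin-basis

dot-basisʳ : ∀ (x : Vecℚ n) (j : Fin n) → dot x (basis j) ≡ x j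
dot-basisʳ x j = trans (dot-comm x (basis j)) (dot-basisˡ j x)

dot-zeroˡ : ∀ (y : Vecℚ n) → dot zeroV y ≡ 0ℚ
dot-zeroˡ {n} y = trans (sumFin-cong (λ i → *-zeroˡ (y i))) (sumFin-zero {n})

dot-+ˡ : ∀ (x y z : Vecℚ n) → dot (x +ᵥ y) z ≡ dot x z + dot y z
dot-+ˡ x y z = trans (sumFin-cong (λ i → *-distribʳ-+ (z i) (x i) (y i))) (sumFin-+ (λ i → x i * z i) (λ i → y i * z i))

dot-+ʳ : ∀ (x y z : Vecℚ n) → dot x (y +ᵥ z) ≡ dot x y + dot x z
dot-+ʳ x y z = trans (sumFin-cong (λ i → *-distribˡ-+ (x i) (y i) (z i))) (sumFin-+ (λ i → x i * y i) (λ i → x i * z i))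

dot-*ˡ : ∀ c (x y : Vecℚ n) → dot (c ·ᵥ x) y ≡ c * dot x y
dot-*ˡ c x y = trans (sumFin-cong (λ i → *-assoc c (x i) (y i))) (sumFin-* c (λ i → x i * y i))

dot-*ʳ : ∀ (x : Vecℚ n) c (y : Vecℚ n) → dot x (c ·ᵥ y) ≡ c * dot x y
dot-*ʳ x c y = trans (dot-comm x (c ·ᵥ y)) (trans (dot-*ˡ c y x) (cong (c *_) (dot-comm y x)))

dot-onesʳ : ∀ (x : Vecℚ n) → dot x onesV ≡ sumFin x
dot-onesʳ x = sumFin-cong (λ i → *-identityʳ (x i))

dot--ˡ : ∀ (x y z : Vecℚ n) → dot (λ i → x i - y i) z ≡ dot x z - dot y z
dot--ˡ x y z = begin
  dot (λ i → x i - y i) z                     ≡⟨ sumFin-cong (λ i → solve 3 (λ a b c → (a :- b) :* c := a :* c :+ (:- con 1ℚ) :* (b :* c)) refl (x i) (y i) (z i)) ⟩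
  sumFin (λ i → x i * z i + (- 1ℚ) * (y i * z i)) ≡⟨ trans (sumFin-+ (λ i → x i * z i) _) (cong (_+_ (dot x z)) (sumFin-* (- 1ℚ) (λ i → y i * z i))) ⟩
  dot x z + (- 1ℚ) * dot y z                  ≡⟨ solve 2 (λ a b → a :+ (:- con 1ℚ) :* b := a :- b) refl (dot x z) (dot y z) ⟩
  dot x z - dot y z                           ∎
  where open ≡-Reasoning

-- Convex hulls and cones

Weighted : List (Vecℚ n) → ℚ × Vecℚ n → Set
Weighted vs p = (0ℚ ≤ proj₁ p) × (proj₂ p ∈ vs)

Cone : List (Vecℚ n) → Vecℚ n → Set
Cone {n} vs x = ∃ λ (cs : List (ℚ × Vecℚ n)) → All (Weighted vs) cs × (combo cs ≐ x)

dot-combo-∷ : ∀ c (v : Vecℚ n) cs y → dot (combo ((c , v) ∷ cs)) y ≡ c * dot v y + dot (combo cs) y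
dot-combo-∷ c v cs y = trans (dot-+ˡ (c ·ᵥ v) (combo cs) y) (cong (_+ dot (combo cs) y) (dot-*ˡ c v y))

module _ {vs : List (Vecℚ n)} {y : Vecℚ n} where
  open ≤-Reasoning

  combo-dot-≥ : ∀ {m} → (∀ {v} → v ∈ vs → m ≤ dot v y) →
                ∀ {cs} → All (Weighted vs) cs → m * sumCoeffs cs ≤ dot (combo cs) y
  combo-dot-≥ {m} m≤ [] = ≤-reflexive (trans (*-zeroʳ m) (sym (dot-zeroˡ y)))
  combo-dot-≥ {m} m≤ {(c , v) ∷ cs} ((0≤c , v∈vs) ∷ ws) = begin
    m * (c + sumCoeffs cs)          ≡⟨ *-distribˡ-+ m c (sumCoeffs cs) ⟩
    m * c + m * sumCoeffs cs        ≡⟨ cong (_+ m * sumCoeffs cs) (*-comm m c) ⟩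
    c * m + m * sumCoeffs cs        ≤⟨ +-mono-≤ (*-monoˡ-≤-0≤ 0≤c (m≤ v∈vs)) (combo-dot-≥ m≤ ws) ⟩
    c * dot v y + dot (combo cs) y  ≡⟨ dot-combo-∷ c v cs y ⟨
    dot (combo ((c , v) ∷ cs)) y    ∎

  combo-dot-≤ : ∀ {M} → (∀ {v} → v ∈ vs → dot v y ≤ M) →
                ∀ {cs} → All (Weighted vs) cs → dot (combo cs) y ≤ M * sumCoeffs cs
  combo-dot-≤ {M} ≤M [] = ≤-reflexive (trans (dot-zeroˡ y) (sym (*-zeroʳ M)))
  combo-dot-≤ {M} ≤M {(c , v) ∷ cs} ((0≤c , v∈vs) ∷ ws) = begin
    dot (combo ((c , v) ∷ cs)) y    ≡⟨ dot-combo-∷ c v cs y ⟩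
    c * dot v y + dot (combo cs) y  ≤⟨ +-mono-≤ (*-monoˡ-≤-0≤ 0≤c (≤M v∈vs)) (combo-dot-≤ ≤M ws) ⟩
    c * M + M * sumCoeffs cs        ≡⟨ cong (_+ M * sumCoeffs cs) (*-comm c M) ⟩
    M * c + M * sumCoeffs cs        ≡⟨ *-distribˡ-+ M c (sumCoeffs cs) ⟨
    M * (c + sumCoeffs cs)          ∎

  InConv-dot-≥ : ∀ {m x} → (∀ {v} → v ∈ vs → m ≤ dot v y) → InConv vs x → m ≤ dot x y
  InConv-dot-≥ {m} m≤ (cs , ws , Σcs≡1 , combo≐x) = subst₂ _≤_
    (trans (cong (m *_) Σcs≡1) (*-identityʳ m)) (dot-congˡ y combo≐x) (combo-dot-≥ m≤ ws)

  InConv-dot-≤ : ∀ {M x} → (∀ {v} → v ∈ vs → dot v y ≤ M) → InConv vs x → dot x y ≤ M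
  InConv-dot-≤ {M} ≤M (cs , ws , Σcs≡1 , combo≐x) = subst₂ _≤_
    (dot-congˡ y combo≐x) (trans (cong (M *_) Σcs≡1) (*-identityʳ M)) (combo-dot-≤ ≤M ws)

  InConv-dot-≡ : ∀ {c x} → (∀ {v} → v ∈ vs → dot v y ≡ c) → InConv vs x → dot x y ≡ c
  InConv-dot-≡ ≡c x∈ = ≤-antisym (InConv-dot-≤ (≤-reflexive ∘ ≡c) x∈) (InConv-dot-≥ (≤-reflexive ∘ sym ∘ ≡c) x∈)

  module _ {M : ℚ} {u : Vecℚ n}
           (≤M : ∀ {v} → v ∈ vs → dot v y ≤ M) (≡M⇒u : ∀ {v} → v ∈ vs → dot v y ≡ M → v ≐ u) where

    combo-exposed : ∀ {cs} → All (Weighted vs) cs → M * sumCoeffs cs ≤ dot (combo cs) y →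
                    combo cs ≐ (sumCoeffs cs ·ᵥ u)
    combo-exposed [] _ i = sym (*-zeroˡ (u i))
    combo-exposed {(c , v) ∷ cs} ((0≤c , v∈vs) ∷ ws) M≤ i = begin-equality
      c * v i + combo cs i           ≡⟨ cong₂ _+_ head (combo-exposed ws (+-squeezeʳ cv≤cM M≤′) i) ⟩
      c * u i + sumCoeffs cs * u i   ≡⟨ *-distribʳ-+ (u i) c (sumCoeffs cs) ⟨
      (c + sumCoeffs cs) * u i       ∎
      where
      cv≤cM : c * dot v y ≤ c * M
      cv≤cM = *-monoˡ-≤-0≤ 0≤c (≤M v∈vs)
      M≤′ : c * M + M * sumCoeffs cs ≤ c * dot v y + dot (combo cs) y
      M≤′ = subst₂ _≤_ (solve 3 (λ M c s → M :* (c :+ s) := c :* M :+ M :* s) refl M c (sumCoeffs cs))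
              (dot-combo-∷ c v cs y) M≤
      head : c * v i ≡ c * u i
      head with 0ℚ <? c
      ... | yes 0<c = cong (c *_) (≡M⇒u v∈vs (≤-antisym (≤M v∈vs)
              (*-cancelˡ-≤-pos c {{positive 0<c}} (+-squeezeˡ (combo-dot-≤ ≤M ws) M≤′))) i)
      ... | no 0≮c  = trans (cong (_* v i) c≡0) (trans (*-zeroˡ (v i))
              (sym (trans (cong (_* u i) c≡0) (*-zeroˡ (u i)))))
        where c≡0 = ≤-antisym (≮⇒≥ 0≮c) 0≤c

    InConv-exposed : ∀ {x} → InConv vs x → M ≤ dot x y → x ≐ u
    InConv-exposed {x} (cs , ws , Σcs≡1 , combo≐x) M≤ i = begin-equality
      x i                ≡⟨ combo≐x i ⟨
      combo cs i         ≡⟨ combo-exposed ws M≤′ i ⟩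
      sumCoeffs cs * u i ≡⟨ cong (_* u i) Σcs≡1 ⟩
      1ℚ * u i           ≡⟨ *-identityˡ (u i) ⟩
      u i                ∎
      where
      M≤′ : M * sumCoeffs cs ≤ dot (combo cs) y
      M≤′ = subst₂ _≤_ (sym (trans (cong (M *_) Σcs≡1) (*-identityʳ M))) (sym (dot-congˡ y combo≐x)) M≤

    InConv-exposed-isVertex : ∀ {x} → InConv vs x → M ≤ dot x y → IsVertex (InConv vs) x
    InConv-exposed-isVertex {x} x∈ M≤ = x∈ , extreme
      where
      extreme : ∀ p q t → InConv vs p → InConv vs q → 0ℚ < t → t < 1ℚ →
                ((t ·ᵥ p) +ᵥ ((1ℚ - t) ·ᵥ q)) ≐ x → p ≐ q
      extreme p q t p∈ q∈ 0<t t<1 mix≐x i = trans (InConv-exposed p∈ M≤p i) (sym (InConv-exposed q∈ M≤q i))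
        where
        M≤mix : M ≤ t * dot p y + (1ℚ - t) * dot q y
        M≤mix = subst (M ≤_) (trans (sym (dot-congˡ y mix≐x))
          (trans (dot-+ˡ (t ·ᵥ p) ((1ℚ - t) ·ᵥ q) y) (cong₂ _+_ (dot-*ˡ t p y) (dot-*ˡ (1ℚ - t) q y)))) M≤
        M≤p : M ≤ dot p y
        M≤p = convex-≥ 0<t (<⇒≤ (p<q⇒0<q-p t<1)) M≤mix (InConv-dot-≤ ≤M q∈)
        M≤q : M ≤ dot q y
        M≤q = convex-≥ (p<q⇒0<q-p t<1) (subst (0ℚ ≤_) (solve 1 (λ t → t := con 1ℚ :- (con 1ℚ :- t)) refl t) (<⇒≤ 0<t))
          (subst (M ≤_) (solve 3 (λ t a b → t :* a :+ (con 1ℚ :- t) :* b := (con 1ℚ :- t) :* b :+ (con 1ℚ :- (con 1ℚ :- t)) :* a)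
            refl t (dot p y) (dot q y)) M≤mix)
          (InConv-dot-≤ ≤M p∈)

InConv-resp : ∀ {vs : List (Vecℚ n)} {x x′} → x ≐ x′ → InConv vs x → InConv vs x′
InConv-resp x≐x′ (cs , ws , Σcs≡1 , combo≐x) = cs , ws , Σcs≡1 , λ i → trans (combo≐x i) (x≐x′ i)

sumCoeffs-nonNeg : ∀ {vs : List (Vecℚ n)} {cs} → All (Weighted vs) cs → 0ℚ ≤ sumCoeffs cs
sumCoeffs-nonNeg []               = ≤-refl
sumCoeffs-nonNeg ((0≤c , _) ∷ ws) = +-mono-≤ 0≤c (sumCoeffs-nonNeg ws)

combo-++ : ∀ (cs ds : List (ℚ × Vecℚ n)) → combo (cs ++ ds) ≐ (combo cs +ᵥ combo ds)
combo-++ []             ds i = sym (+-identityˡ (combo ds i))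
combo-++ ((c , v) ∷ cs) ds i = trans (cong (_+_ (c * v i)) (combo-++ cs ds i)) (sym (+-assoc (c * v i) _ _))

sumCoeffs-++ : ∀ (cs ds : List (ℚ × Vecℚ n)) → sumCoeffs (cs ++ ds) ≡ sumCoeffs cs + sumCoeffs ds
sumCoeffs-++ []             ds = sym (+-identityˡ (sumCoeffs ds))
sumCoeffs-++ ((c , v) ∷ cs) ds = trans (cong (_+_ c) (sumCoeffs-++ cs ds)) (sym (+-assoc c _ _))

scaleCoeffs : ℚ → List (ℚ × Vecℚ n) → List (ℚ × Vecℚ n)
scaleCoeffs e = map (λ p → (e * proj₁ p , proj₂ p))

combo-scale : ∀ e (cs : List (ℚ × Vecℚ n)) → combo (scaleCoeffs e cs) ≐ (e ·ᵥ combo cs)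
combo-scale e []             i = sym (*-zeroʳ e)
combo-scale e ((c , v) ∷ cs) i = trans (cong (_+_ (e * c * v i)) (combo-scale e cs i))
  (solve 4 (λ e c a b → e :* c :* a :+ e :* b := e :* (c :* a :+ b)) refl e c (v i) (combo cs i))

sumCoeffs-scale : ∀ e (cs : List (ℚ × Vecℚ n)) → sumCoeffs (scaleCoeffs e cs) ≡ e * sumCoeffs cs
sumCoeffs-scale e []             = sym (*-zeroʳ e)
sumCoeffs-scale e ((c , v) ∷ cs) = trans (cong (_+_ (e * c)) (sumCoeffs-scale e cs)) (sym (*-distribˡ-+ e c _))

All-Weighted-scale : ∀ {vs : List (Vecℚ n)} {e} → 0ℚ ≤ e → ∀ {cs} → All (Weighted vs) cs →
                     All (Weighted vs) (scaleCoeffs e cs)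
All-Weighted-scale 0≤e []                   = []
All-Weighted-scale 0≤e ((0≤c , v∈vs) ∷ ws) = (0≤p*q 0≤e 0≤c , v∈vs) ∷ All-Weighted-scale 0≤e ws

module _ {vs : List (Vecℚ n)} where

  Cone-resp : ∀ {x x'} → x ≐ x' → Cone vs x → Cone vs x'
  Cone-resp x≐x' (cs , ws , combo≐x) = cs , ws , λ i → trans (combo≐x i) (x≐x' i)

  Cone-zero : Cone vs zeroV
  Cone-zero = [] , [] , λ _ → refl

  Cone-+ : ∀ {x y} → Cone vs x → Cone vs y → Cone vs (x +ᵥ y)
  Cone-+ (cs , ws , combo≐x) (ds , ws′ , combo≐y) = cs ++ ds , All.++⁺ ws ws′ ,
    λ i → trans (combo-++ cs ds i) (cong₂ _+_ (combo≐x i) (combo≐y i))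

  Cone-scale : ∀ {e x} → 0ℚ ≤ e → Cone vs x → Cone vs (e ·ᵥ x)
  Cone-scale {e} 0≤e (cs , ws , combo≐x) = scaleCoeffs e cs , All-Weighted-scale 0≤e ws ,
    λ i → trans (combo-scale e cs i) (cong (e *_) (combo≐x i))

  Cone-sum : ∀ {m} (f : Fin m → Vecℚ n) → (∀ j → Cone vs (f j)) → Cone vs (λ i → sumFin (λ j → f j i))
  Cone-sum {zero}  f f∈ = Cone-zero
  Cone-sum {suc m} f f∈ = Cone-+ (f∈ zero) (Cone-sum (f ∘ suc) (f∈ ∘ suc))

  -- Adding a positive representation of 0 and rescaling turns a conic combination into a convex one.
  Cone⇒InConv-scaled : ∀ {cs₀} → All (Weighted vs) cs₀ → combo cs₀ ≐ zeroV → 0ℚ < sumCoeffs cs₀ →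
                       ∀ {x} → Cone vs x → ∃ λ w → 0ℚ < w × InConv vs (w ·ᵥ x)
  Cone⇒InConv-scaled {cs₀} ws₀ combo₀≐0 0<Σ₀ {x} (cs , ws , combo≐x) =
    w , 0<w , scaleCoeffs w L , All-Weighted-scale (<⇒≤ 0<w) (All.++⁺ ws ws₀) , Σ≡1 , combo≐wx
    where
    L = cs ++ cs₀
    0<T : 0ℚ < sumCoeffs L
    0<T = subst (0ℚ <_) (sym (sumCoeffs-++ cs cs₀)) (+-mono-≤-< (sumCoeffs-nonNeg ws) 0<Σ₀)
    instance
      T-pos : Positive (sumCoeffs L)
      T-pos = positive 0<T
      T-nonZero : NonZero (sumCoeffs L)
      T-nonZero = pos⇒nonZero (sumCoeffs L)
    w = 1/ sumCoeffs L
    0<w : 0ℚ < w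
    0<w = positive⁻¹ w {{1/pos⇒pos (sumCoeffs L)}}
    Σ≡1 : sumCoeffs (scaleCoeffs w L) ≡ 1ℚ
    Σ≡1 = trans (sumCoeffs-scale w L) (*-inverseˡ (sumCoeffs L))
    combo≐wx : combo (scaleCoeffs w L) ≐ (w ·ᵥ x)
    combo≐wx i = trans (combo-scale w L i) (cong (w *_)
      (trans (combo-++ cs cs₀ i) (trans (cong₂ _+_ (combo≐x i) (combo₀≐0 i)) (+-identityʳ (x i)))))

sumCoeffs-tabulate : ∀ {m} (g : Fin m → ℚ × Vecℚ n) → sumCoeffs (tabulate g) ≡ sumFin (proj₁ ∘ g)
sumCoeffs-tabulate {m = zero}  g = refl
sumCoeffs-tabulate {m = suc m} g = cong (_+_ (proj₁ (g zero))) (sumCoeffs-tabulate (g ∘ suc))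

combo-tabulate : ∀ {m} (g : Fin m → ℚ × Vecℚ n) →
                 combo (tabulate g) ≐ (λ i → sumFin (λ k → proj₁ (g k) * proj₂ (g k) i))
combo-tabulate {m = zero}  g i = refl
combo-tabulate {m = suc m} g i = cong (_+_ (proj₁ (g zero) * proj₂ (g zero) i)) (combo-tabulate (g ∘ suc) i)

InConv-average : ∀ {m} {vs : List (Vecℚ n)} (f : Fin (suc m) → Vecℚ n) → (∀ k → f k ∈ vs) →
                 InConv vs (λ i → (+ 1 / suc m) * sumFin (λ k → f k i))
InConv-average {m = m} f f∈vs =
  tabulate (λ k → c , f k) , All.tabulate⁺ (λ k → 0≤c , f∈vs k) ,
  trans (sumCoeffs-tabulate (λ k → c , f k)) (trans (sumFin-const (suc m) c) (ι[1+m]*1/[1+m] m)) ,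
  λ i → trans (combo-tabulate (λ k → c , f k) i) (sumFin-* c (λ k → f k i))
  where
  c = + 1 / suc m
  0≤c : 0ℚ ≤ c
  0≤c = nonNegative⁻¹ c {{normalize-nonNeg 1 (suc m)}}

InConv-∈ : ∀ {vs : List (Vecℚ n)} {v} → v ∈ vs → InConv vs v
InConv-∈ {v = v} v∈vs = (1ℚ , v) ∷ [] , (<⇒≤ 0<1 , v∈vs) ∷ [] , refl ,
  λ i → trans (+-identityʳ (1ℚ * v i)) (*-identityˡ (v i))

Cone-∈ : ∀ {vs : List (Vecℚ n)} {v} → v ∈ vs → Cone vs v
Cone-∈ v∈vs = let (cs , ws , _ , combo≐v) = InConv-∈ v∈vs in cs , ws , combo≐v

-- Vertices of Q̄ and potentials

V̄ : ℕ → Set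
V̄ n = Fin n ⊎ ⊤

src tgt : Arrow n ℓ → V̄ n
src a = collapse (source a)
tgt a = collapse (target a)

vertexVec : V̄ n → Vecℚ n
vertexVec (inj₁ i) = basis i
vertexVec (inj₂ _) = zeroV

pot : Vecℚ n → V̄ n → ℚ
pot y (inj₁ i) = y i
pot y (inj₂ _) = 0ℚ

edgeVec : V̄ n → V̄ n → Vecℚ n
edgeVec x x′ i = vertexVec x′ i - vertexVec x i

rootVec≐edgeVec : ∀ (a : Arrow n ℓ) → rootVec a ≐ edgeVec (src a) (tgt a)
rootVec≐edgeVec (nn i j) k = refl
rootVec≐edgeVec (ns i _) k = solve 1 (λ b → :- b := con 0ℚ :- b) refl (basis i k)
rootVec≐edgeVec (sn _ j) k = solve 1 (λ b → b := b :- con 0ℚ) refl (basis j k)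

dot-vertexVec : ∀ (x : V̄ n) y → dot (vertexVec x) y ≡ pot y x
dot-vertexVec (inj₁ i) y = dot-basisˡ i y
dot-vertexVec (inj₂ _) y = dot-zeroˡ y

dot-edgeVec : ∀ (x x′ : V̄ n) y → dot (edgeVec x x′) y ≡ pot y x′ - pot y x
dot-edgeVec x x′ y = trans (dot--ˡ (vertexVec x′) (vertexVec x) y) (cong₂ _-_ (dot-vertexVec x′ y) (dot-vertexVec x y))

dot-rootVec : ∀ (a : Arrow n ℓ) y → dot (rootVec a) y ≡ pot y (tgt a) - pot y (src a)
dot-rootVec a y = trans (dot-congˡ y (rootVec≐edgeVec a)) (dot-edgeVec (src a) (tgt a) y)

module _ {arr : List (Arrow n ℓ)} where

  ∀-rootVecs : ∀ (P : Vecℚ n → Set) → (∀ {a} → a ∈ arr → P (rootVec a)) → ∀ {v} → v ∈ map rootVec arr → P v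
  ∀-rootVecs P P-root v∈ with ∈-map⁻ rootVec v∈
  ... | a , a∈arr , refl = P-root a∈arr

  Root-rootVec : ∀ {a} → a ∈ arr → Root arr (rootVec a)
  Root-rootVec = InConv-∈ ∘ ∈-map⁺ rootVec

  path-cone : ∀ {x y} → Star (EdgeQbar arr) x y → Cone (map rootVec arr) (edgeVec x y)
  path-cone {x} ε = Cone-resp (λ k → sym (+-inverseʳ (vertexVec x k))) Cone-zero
  path-cone {x} {y} ((a , a∈arr , refl , refl) ◅ p) = Cone-resp telescope
    (Cone-+ (Cone-resp (rootVec≐edgeVec a) (Cone-∈ (∈-map⁺ rootVec a∈arr))) (path-cone p))
    where
    telescope : (edgeVec (src a) (tgt a) +ᵥ edgeVec (tgt a) y) ≐ edgeVec (src a) y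
    telescope k = solve 3 (λ s t y → t :- s :+ (y :- t) := y :- s) refl (vertexVec (src a) k) (vertexVec (tgt a) k) (vertexVec y k)

  line-cone : ∀ {x y} → Star (EdgeQbar arr) x y → Star (EdgeQbar arr) y x →
              ∀ c → Cone (map rootVec arr) (c ·ᵥ edgeVec x y)
  line-cone {x} {y} x→y y→x c with 0ℚ ≤? c
  ... | yes 0≤c = Cone-scale 0≤c (path-cone x→y)
  ... | no 0≰c  = Cone-resp reverse (Cone-scale (neg-antimono-≤ (<⇒≤ (≰⇒> 0≰c))) (path-cone y→x))
    where
    reverse : ((- c) ·ᵥ edgeVec y x) ≐ (c ·ᵥ edgeVec x y)
    reverse k = solve 3 (λ c a b → (:- c) :* (a :- b) := c :* (b :- a)) refl c (vertexVec x k) (vertexVec y k)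

  -- An arrow followed by a path back to its source.
  positive-circuit : StronglyConnected arr → ∀ {a} → a ∈ arr →
    ∃ λ cs → All (Weighted (map rootVec arr)) cs × (combo cs ≐ zeroV) × (0ℚ < sumCoeffs cs)
  positive-circuit sc {a} a∈arr with path-cone (sc (target a) (source a))
  ... | ps , ws , combo≐back =
    (1ℚ , rootVec a) ∷ ps , (<⇒≤ 0<1 , ∈-map⁺ rootVec a∈arr) ∷ ws , combo≐0 ,
    +-mono-<-≤ 0<1 (sumCoeffs-nonNeg ws)
    where
    combo≐0 : combo ((1ℚ , rootVec a) ∷ ps) ≐ zeroV
    combo≐0 k = trans (cong₂ _+_ (trans (*-identityˡ (rootVec a k)) (rootVec≐edgeVec a k)) (combo≐back k))
      (solve 2 (λ s t → t :- s :+ (s :- t) := con 0ℚ) refl (vertexVec (src a) k) (vertexVec (tgt a) k))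

-- The origin is interior

baseVertex : ∀ ℓ → Vertex (suc n) ℓ
baseVertex zero    = inj₁ zero
baseVertex (suc ℓ) = inj₂ zero

dot-rootVec-ones : ∀ (a : Arrow n zero) → dot (rootVec a) onesV ≡ 0ℚ
dot-rootVec-ones (nn i j) = trans (dot-rootVec {ℓ = zero} (nn i j) onesV) (+-inverseʳ 1ℚ)

Root⇒InSpan : ∀ {arr : List (Arrow n ℓ)} {x} → Root arr x → InSpan ℓ x
Root⇒InSpan {ℓ = zero}  {x = x} x∈ =
  trans (sym (dot-onesʳ x)) (InConv-dot-≡ (∀-rootVecs (λ v → dot v onesV ≡ 0ℚ) (λ {a} _ → dot-rootVec-ones a)) x∈)
Root⇒InSpan {ℓ = suc ℓ} x∈ = tt

InSpan⇒base*sum≡0 : ∀ {d : Vecℚ (suc n)} → InSpan ℓ d → ∀ k → vertexVec (collapse (baseVertex {n} ℓ)) k * sumFin d ≡ 0ℚ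
InSpan⇒base*sum≡0 {ℓ = zero}  Σd≡0 k = trans (cong (basis zero k *_) Σd≡0) (*-zeroʳ (basis zero k))
InSpan⇒base*sum≡0 {ℓ = suc ℓ} {d = d} _ k = *-zeroˡ (sumFin d)

span-decomposition : ∀ (d : Vecℚ n) (x : V̄ n) →
  (λ k → sumFin (λ i → (d i ·ᵥ edgeVec x (inj₁ i)) k)) ≐ (λ k → d k - vertexVec x k * sumFin d)
span-decomposition d x k = begin
  sumFin (λ i → d i * (basis i k - c))            ≡⟨ sumFin-cong (λ i → solve 3 (λ a b c → a :* (b :- c) := b :* a :+ (:- c) :* a) refl (d i) (basis i k) c) ⟩
  sumFin (λ i → basis i k * d i + (- c) * d i)     ≡⟨ sumFin-+ (λ i → basis i k * d i) (λ i → (- c) * d i) ⟩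
  sumFin (λ i → basis i k * d i) + sumFin (λ i → (- c) * d i)
    ≡⟨ cong₂ _+_ (trans (sumFin-cong (λ i → cong (_* d i) (basis-comm i k))) (sumFin-basis k d)) (sumFin-* (- c) d) ⟩
  d k + (- c) * sumFin d                           ≡⟨ solve 3 (λ a c s → a :+ (:- c) :* s := a :- c :* s) refl (d k) c (sumFin d) ⟩
  d k - c * sumFin d                               ∎
  where
  c = vertexVec x k
  open ≡-Reasoning

InSpan⇒RootCone : ∀ {arr : List (Arrow (suc n) ℓ)} → StronglyConnected arr →
                  ∀ {d} → InSpan ℓ d → Cone (map rootVec arr) d
InSpan⇒RootCone {n} {ℓ} sc {d} d∈span = Cone-resp d≐
  (Cone-sum (λ i → d i ·ᵥ edgeVec b̄ (inj₁ i)) (λ i → line-cone (sc b (inj₁ i)) (sc (inj₁ i) b) (d i)))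
  where
  b = baseVertex {n} ℓ
  b̄ = collapse b
  d≐ : (λ k → sumFin (λ i → (d i ·ᵥ edgeVec b̄ (inj₁ i)) k)) ≐ d
  d≐ k = trans (span-decomposition d b̄ k)
    (trans (cong (_-_ (d k)) (InSpan⇒base*sum≡0 d∈span k)) (+-identityʳ (d k)))

originInRelInt : ∀ {arr : List (Arrow (suc n) ℓ)} → StronglyConnected arr → ∀ {a} → a ∈ arr →
                 OriginInRelInt ℓ (Root arr)
originInRelInt {arr = arr} sc a∈arr =
  let (_ , ws₀ , combo₀≐0 , 0<Σ₀) = positive-circuit {arr = arr} sc a∈arr in
  (λ _ → Root⇒InSpan {arr = arr}) , λ d d∈span → Cone⇒InConv-scaled ws₀ combo₀≐0 0<Σ₀ (InSpan⇒RootCone sc d∈span)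

-- Lattice points of Root(Q)

pot-basis-bounds : ∀ (k : Fin n) (v : V̄ n) → 0ℚ ≤ pot (basis k) v × pot (basis k) v ≤ 1ℚ
pot-basis-bounds k (inj₁ m) = basis-nonNeg k m , basis-≤1 k m
pot-basis-bounds k (inj₂ _) = ≤-refl , <⇒≤ 0<1

Root-coord-bounds : ∀ {arr : List (Arrow n ℓ)} {x} → Root arr x → ∀ k → - 1ℚ ≤ x k × x k ≤ 1ℚ
Root-coord-bounds {arr = arr} {x} x∈ k =
  subst (- 1ℚ ≤_) (dot-basisʳ x k) (InConv-dot-≥ (∀-rootVecs (λ v → - 1ℚ ≤ dot v (basis k)) lower) x∈) ,
  subst (_≤ 1ℚ) (dot-basisʳ x k) (InConv-dot-≤ (∀-rootVecs (λ v → dot v (basis k) ≤ 1ℚ) upper) x∈)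
  where
  lower : ∀ {a} → a ∈ arr → - 1ℚ ≤ dot (rootVec a) (basis k)
  lower {a} _ = subst (- 1ℚ ≤_) (sym (dot-rootVec a (basis k)))
    (+-mono-≤ (proj₁ (pot-basis-bounds k (tgt a))) (neg-antimono-≤ (proj₂ (pot-basis-bounds k (src a)))))
  upper : ∀ {a} → a ∈ arr → dot (rootVec a) (basis k) ≤ 1ℚ
  upper {a} _ = subst (_≤ 1ℚ) (sym (dot-rootVec a (basis k)))
    (+-mono-≤ (proj₂ (pot-basis-bounds k (tgt a))) (neg-antimono-≤ (proj₁ (pot-basis-bounds k (src a)))))

UnitCoords : (Fin n → ℤ) → Set
UnitCoords z = ∀ k → z k ≡ -[1+ 0 ] ⊎ z k ≡ + 0 ⊎ z k ≡ + 1

Root-unitCoords : ∀ {arr : List (Arrow n ℓ)} {z} → Root arr (embed z) → UnitCoords z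
Root-unitCoords {z = z} z∈ k =
  unit-interval (ι-cancel-≤ (proj₁ (Root-coord-bounds z∈ k))) (ι-cancel-≤ (proj₂ (Root-coord-bounds z∈ k)))
  where
  unit-interval : ∀ {m} → -[1+ 0 ] ℤ.≤ m → m ℤ.≤ + 1 → m ≡ -[1+ 0 ] ⊎ m ≡ + 0 ⊎ m ≡ + 1
  unit-interval { -[1+ 0 ]}    _          _               = inj₁ refl
  unit-interval {+ 0}          _          _               = inj₂ (inj₁ refl)
  unit-interval {+ 1}          _          _               = inj₂ (inj₂ refl)
  unit-interval { -[1+ suc _ ]} (-≤- ()) _
  unit-interval {+ suc (suc _)} _          (+≤+ (s≤s ()))

module _ {z : Fin n → ℤ} (coords : UnitCoords z) where

  unitCoords-nonNeg : ¬ (∃ λ k → z k ≡ -[1+ 0 ]) → ∀ k → 0ℚ ≤ embed z k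
  unitCoords-nonNeg ∄-1 k with coords k
  ... | inj₁ zk≡-1        = ⊥-elim (∄-1 (k , zk≡-1))
  ... | inj₂ (inj₁ zk≡0) = ≤-reflexive (sym (cong ι zk≡0))
  ... | inj₂ (inj₂ zk≡1) = subst (0ℚ ≤_) (sym (cong ι zk≡1)) (<⇒≤ 0<1)

  unitCoords-nonPos : ¬ (∃ λ k → z k ≡ + 1) → ∀ k → embed z k ≤ 0ℚ
  unitCoords-nonPos ∄1 k with coords k
  ... | inj₁ zk≡-1        = subst (_≤ 0ℚ) (sym (cong ι zk≡-1)) (neg-antimono-≤ (<⇒≤ 0<1))
  ... | inj₂ (inj₁ zk≡0) = ≤-reflexive (cong ι zk≡0)
  ... | inj₂ (inj₂ zk≡1) = ⊥-elim (∄1 (k , zk≡1))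

  unitCoords-zero : ¬ (∃ λ k → z k ≡ + 1) → ¬ (∃ λ k → z k ≡ -[1+ 0 ]) → embed z ≐ zeroV
  unitCoords-zero ∄1 ∄-1 k = ≤-antisym (unitCoords-nonPos ∄1 k) (unitCoords-nonNeg ∄-1 k)

_≟V_ : ∀ (x y : V̄ n) → Dec (x ≡ y)
_≟V_ = Sum.≡-dec Fin._≟_ Unit._≟_

δ : V̄ n → V̄ n → ℚ
δ x v with x ≟V v
... | yes _ = 1ℚ
... | no _  = 0ℚ

δ-self : ∀ (x : V̄ n) → δ x x ≡ 1ℚ
δ-self x with x ≟V x
... | yes _  = refl
... | no x≢x = ⊥-elim (x≢x refl)

δ-other : ∀ {x v : V̄ n} → x ≢ v → δ x v ≡ 0ℚ
δ-other {x = x} {v} x≢v with x ≟V v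
... | yes x≡v = ⊥-elim (x≢v x≡v)
... | no _    = refl

δ-nonNeg : ∀ (x v : V̄ n) → 0ℚ ≤ δ x v
δ-nonNeg x v with x ≟V v
... | yes _ = <⇒≤ 0<1
... | no _  = ≤-refl

δ-vertexVec : ∀ (x : V̄ n) k → δ x (inj₁ k) ≡ vertexVec x k
δ-vertexVec (inj₁ j) k with j Fin.≟ k
... | yes _ = refl
... | no _  = refl
δ-vertexVec (inj₂ _) k = refl

sep : V̄ n → V̄ n → V̄ n → ℚ
sep X Y v = δ X v - δ Y v

fromPotential : (V̄ n → ℚ) → Vecℚ n
fromPotential h k = h (inj₁ k) - h (inj₂ tt)

pot-fromPotential : ∀ (h : V̄ n → ℚ) v → pot (fromPotential h) v ≡ h v - h (inj₂ tt)
pot-fromPotential h (inj₁ k)  = refl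
pot-fromPotential h (inj₂ tt) = sym (+-inverseʳ (h (inj₂ tt)))

dot-rootVec-fromPotential : ∀ (a : Arrow n ℓ) h → dot (rootVec a) (fromPotential h) ≡ h (tgt a) - h (src a)
dot-rootVec-fromPotential a h = trans (dot-rootVec a (fromPotential h))
  (trans (cong₂ _-_ (pot-fromPotential h (tgt a)) (pot-fromPotential h (src a)))
    (solve 3 (λ t s c → t :- c :- (s :- c) := t :- s) refl (h (tgt a)) (h (src a)) (h (inj₂ tt))))

dot-fromPotential-sep : ∀ (x : Vecℚ n) X Y →
  dot x (fromPotential (sep X Y)) ≡ (pot x X - pot x Y) - sep X Y (inj₂ tt) * sumFin x
dot-fromPotential-sep x X Y = begin
  dot x (fromPotential (sep X Y))
    ≡⟨ sumFin-cong (λ k → solve 3 (λ a b c → a :* (b :- c) := a :* b :+ (:- c) :* a) refl (x k) (sep X Y (inj₁ k)) c) ⟩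
  sumFin (λ k → x k * sep X Y (inj₁ k) + (- c) * x k)
    ≡⟨ trans (sumFin-+ (λ k → x k * sep X Y (inj₁ k)) _) (cong (_+_ (dot x (λ k → sep X Y (inj₁ k)))) (sumFin-* (- c) x)) ⟩
  dot x (λ k → sep X Y (inj₁ k)) + (- c) * sumFin x
    ≡⟨ cong (_+ (- c) * sumFin x) (trans (dot-congʳ x (λ k → cong₂ _-_ (δ-vertexVec X k) (δ-vertexVec Y k)))
         (trans (dot-comm x (edgeVec Y X)) (dot-edgeVec Y X x))) ⟩
  (pot x X - pot x Y) + (- c) * sumFin x
    ≡⟨ solve 3 (λ d c s → d :+ (:- c) :* s := d :- c :* s) refl (pot x X - pot x Y) c (sumFin x) ⟩
  (pot x X - pot x Y) - c * sumFin x ∎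
  where
  c = sep X Y (inj₂ tt)
  open ≡-Reasoning

module _ {X Y : V̄ n} (X≢Y : X ≢ Y) where

  sep-top : sep X Y X ≡ 1ℚ
  sep-top = trans (cong₂ _-_ (δ-self X) (δ-other (X≢Y ∘ sym))) (+-identityʳ 1ℚ)

  sep-bottom : sep X Y Y ≡ - 1ℚ
  sep-bottom = trans (cong₂ _-_ (δ-other X≢Y) (δ-self Y)) (+-identityˡ (- 1ℚ))

  sep-<-top : ∀ v → v ≢ X → sep X Y v < sep X Y X
  sep-<-top v v≢X = subst₂ _<_ (sym (cong (_- δ Y v) (δ-other (v≢X ∘ sym)))) (sym sep-top)
    (≤-<-trans (+-monoʳ-≤ 0ℚ (neg-antimono-≤ (δ-nonNeg Y v))) 0<1)

  sep->-bottom : ∀ v → v ≢ Y → sep X Y Y < sep X Y v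
  sep->-bottom v v≢Y = subst₂ _<_ (sym sep-bottom) (sym (trans (cong (_-_ (δ X v)) (δ-other (v≢Y ∘ sym))) (+-identityʳ (δ X v))))
    (<-≤-trans (neg-antimono-< 0<1) (δ-nonNeg X v))

module _ {arr : List (Arrow n ℓ)} (h : V̄ n → ℚ) {X Y : V̄ n}
         (top : ∀ v → v ≢ X → h v < h X) (bottom : ∀ v → v ≢ Y → h Y < h v) where

  private
    ≤-top : ∀ v → h v ≤ h X
    ≤-top v with v ≟V X
    ... | yes refl = ≤-refl
    ... | no v≢X   = <⇒≤ (top v v≢X)

    bottom-≤ : ∀ v → h Y ≤ h v
    bottom-≤ v with v ≟V Y
    ... | yes refl = ≤-refl
    ... | no v≢Y   = <⇒≤ (bottom v v≢Y)

  -- Only arrows from Y to X reach the maximum h X - h Y of the functional.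
  Root-exposed-isVertex : ∀ {x} → Root arr x → h X - h Y ≤ dot x (fromPotential h) → IsVertex (Root arr) x
  Root-exposed-isVertex = InConv-exposed-isVertex {u = edgeVec Y X}
    (∀-rootVecs (λ v → dot v (fromPotential h) ≤ h X - h Y) ≤M)
    (∀-rootVecs (λ v → dot v (fromPotential h) ≡ h X - h Y → v ≐ edgeVec Y X) ≡M⇒edge)
    where
    ≤M : ∀ {a} → a ∈ arr → dot (rootVec a) (fromPotential h) ≤ h X - h Y
    ≤M {a} _ = subst (_≤ h X - h Y) (sym (dot-rootVec-fromPotential a h))
      (+-mono-≤ (≤-top (tgt a)) (neg-antimono-≤ (bottom-≤ (src a))))
    ≡M⇒edge : ∀ {a} → a ∈ arr → dot (rootVec a) (fromPotential h) ≡ h X - h Y → rootVec a ≐ edgeVec Y X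
    ≡M⇒edge {a} _ eq = endpoints (tgt a ≟V X) (src a ≟V Y)
      where
      eq′ : h (tgt a) - h (src a) ≡ h X - h Y
      eq′ = trans (sym (dot-rootVec-fromPotential a h)) eq
      endpoints : Dec (tgt a ≡ X) → Dec (src a ≡ Y) → rootVec a ≐ edgeVec Y X
      endpoints (yes t≡X) (yes s≡Y) k = trans (rootVec≐edgeVec a k) (cong₂ (λ s t → edgeVec s t k) s≡Y t≡X)
      endpoints (no t≢X)  _         = ⊥-elim (<-irrefl eq′
        (+-mono-<-≤ (top (tgt a) t≢X) (neg-antimono-≤ (bottom-≤ (src a)))))
      endpoints (yes _)   (no s≢Y)  = ⊥-elim (<-irrefl eq′
        (+-mono-≤-< (≤-top (tgt a)) (neg-antimono-< (bottom (src a) s≢Y))))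

Root-separated-isVertex : ∀ {arr : List (Arrow n ℓ)} X Y {x} → X ≢ Y → Root arr x →
  1ℚ - (- 1ℚ) ≤ dot x (fromPotential (sep X Y)) → IsVertex (Root arr) x
Root-separated-isVertex {arr = arr} X Y {x} X≢Y x∈ 2≤ =
  Root-exposed-isVertex {arr = arr} (sep X Y) (sep-<-top X≢Y) (sep->-bottom X≢Y) x∈
    (subst (_≤ dot x (fromPotential (sep X Y))) (sym (cong₂ _-_ (sep-top X≢Y) (sep-bottom X≢Y))) 2≤)

module _ (x : Vecℚ n) where
  open ≤-Reasoning

  separation-normal-normal : ∀ {j i} → x j ≡ 1ℚ → x i ≡ - 1ℚ →
    1ℚ - (- 1ℚ) ≤ dot x (fromPotential (sep (inj₁ j) (inj₁ i)))
  separation-normal-normal {j} {i} xj≡1 xi≡-1 = begin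
    1ℚ - (- 1ℚ)                   ≡⟨ solve 1 (λ s → con 1ℚ :- (:- con 1ℚ) := con 1ℚ :- (:- con 1ℚ) :- con 0ℚ :* s) refl (sumFin x) ⟩
    1ℚ - (- 1ℚ) - 0ℚ * sumFin x   ≡⟨ cong₂ (λ a b → a - b - 0ℚ * sumFin x) xj≡1 xi≡-1 ⟨
    x j - x i - 0ℚ * sumFin x     ≡⟨ dot-fromPotential-sep x (inj₁ j) (inj₁ i) ⟨
    dot x (fromPotential (sep (inj₁ j) (inj₁ i))) ∎

  separation-normal-star : ∀ {j} → x j ≡ 1ℚ → (∀ k → 0ℚ ≤ x k) →
    1ℚ - (- 1ℚ) ≤ dot x (fromPotential (sep (inj₁ j) (inj₂ tt)))
  separation-normal-star {j} xj≡1 x≥0 = begin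
    1ℚ + 1ℚ                       ≤⟨ +-monoʳ-≤ 1ℚ (subst (_≤ sumFin x) xj≡1 (sumFin-≥-term x≥0 j)) ⟩
    1ℚ + sumFin x                 ≡⟨ solve 1 (λ s → con 1ℚ :+ s := con 1ℚ :- con 0ℚ :- (con 0ℚ :- con 1ℚ) :* s) refl (sumFin x) ⟩
    1ℚ - 0ℚ - (0ℚ - 1ℚ) * sumFin x ≡⟨ cong (λ a → a - 0ℚ - (0ℚ - 1ℚ) * sumFin x) xj≡1 ⟨
    x j - 0ℚ - (0ℚ - 1ℚ) * sumFin x ≡⟨ dot-fromPotential-sep x (inj₁ j) (inj₂ tt) ⟨
    dot x (fromPotential (sep (inj₁ j) (inj₂ tt))) ∎

  separation-star-normal : ∀ {i} → x i ≡ - 1ℚ → (∀ k → x k ≤ 0ℚ) →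
    1ℚ - (- 1ℚ) ≤ dot x (fromPotential (sep (inj₂ tt) (inj₁ i)))
  separation-star-normal {i} xi≡-1 x≤0 = begin
    1ℚ - (- 1ℚ)                    ≤⟨ +-monoʳ-≤ 1ℚ (neg-antimono-≤ (subst (sumFin x ≤_) xi≡-1 (sumFin-≤-term x≤0 i))) ⟩
    1ℚ - sumFin x                  ≡⟨ solve 1 (λ s → con 1ℚ :- s := con 0ℚ :- (:- con 1ℚ) :- (con 1ℚ :- con 0ℚ) :* s) refl (sumFin x) ⟩
    0ℚ - (- 1ℚ) - (1ℚ - 0ℚ) * sumFin x ≡⟨ cong (λ b → 0ℚ - b - (1ℚ - 0ℚ) * sumFin x) xi≡-1 ⟨
    0ℚ - x i - (1ℚ - 0ℚ) * sumFin x ≡⟨ dot-fromPotential-sep x (inj₂ tt) (inj₁ i) ⟨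
    dot x (fromPotential (sep (inj₂ tt) (inj₁ i))) ∎

terminal : ∀ (arr : List (Arrow n ℓ)) → OnlyLatticePointsOriginAndVertices (Root arr)
terminal arr z z∈ = classify (Fin.any? (λ k → z k ℤ.≟ + 1)) (Fin.any? (λ k → z k ℤ.≟ -[1+ 0 ]))
  where
  coords : UnitCoords z
  coords = Root-unitCoords {arr = arr} {z = z} z∈
  classify : Dec (∃ λ k → z k ≡ + 1) → Dec (∃ λ k → z k ≡ -[1+ 0 ]) →
             (embed z ≐ zeroV) ⊎ IsVertex (Root arr) (embed z)
  classify (yes (j , zj≡1)) (yes (i , zi≡-1)) = inj₂ (Root-separated-isVertex (inj₁ j) (inj₁ i) j≢i z∈
    (separation-normal-normal (embed z) (cong ι zj≡1) (cong ι zi≡-1)))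
    where
    j≢i : inj₁ j ≢ inj₁ i
    j≢i refl with trans (sym zj≡1) zi≡-1
    ... | ()
  classify (yes (j , zj≡1)) (no ∄-1)         = inj₂ (Root-separated-isVertex (inj₁ j) (inj₂ tt) (λ ()) z∈
    (separation-normal-star (embed z) (cong ι zj≡1) (unitCoords-nonNeg coords ∄-1)))
  classify (no ∄1)          (yes (i , zi≡-1)) = inj₂ (Root-separated-isVertex (inj₂ tt) (inj₁ i) (λ ()) z∈
    (separation-star-normal (embed z) (cong ι zi≡-1) (unitCoords-nonPos coords ∄1)))
  classify (no ∄1)          (no ∄-1)          = inj₁ (unitCoords-zero coords ∄1 ∄-1)

-- Floors and Hermite's identity

i<1+j⇒i≤j : ∀ {i j} → i ℤ.< ℤ.suc j → i ℤ.≤ j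
i<1+j⇒i≤j {i} {j} i<1+j = subst (i ℤ.≤_) (ℤ.pred-suc j) (ℤ.i<j⇒i≤pred[j] i<1+j)

private
  suc-+-* : ∀ f q d → (ℤ.1ℤ ℤ.+ (f ℤ.+ q)) ℤ.* d ≡ (ℤ.1ℤ ℤ.+ f) ℤ.* d ℤ.+ q ℤ.* d
  suc-+-* = solve-∀

  +-swapʳ : ∀ a b c → a ℤ.+ b ℤ.+ c ≡ a ℤ.+ c ℤ.+ b
  +-swapʳ = solve-∀

  +-swap-1* : ∀ a b c → a ℤ.+ b ℤ.+ c ≡ a ℤ.+ c ℤ.+ ℤ.1ℤ ℤ.* b
  +-swap-1* = solve-∀

module _ (N : ℕ) .{{_ : ℕ.NonZero N}} where

  /ℕ-mono-≤ : ∀ {a b} → a ℤ.≤ b → a /ℕ N ℤ.≤ b /ℕ N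
  /ℕ-mono-≤ {a} {b} a≤b = i<1+j⇒i≤j (ℤ.*-cancelʳ-<-nonNeg (+ N)
    (ℤ.≤-<-trans ([n/ℕd]*d≤n a N) (ℤ.≤-<-trans a≤b (n<s[n/ℕd]*d b N))))

  /ℕ-unique : ∀ {a q} → q ℤ.* + N ℤ.≤ a → a ℤ.< ℤ.suc q ℤ.* + N → a /ℕ N ≡ q
  /ℕ-unique {a} {q} qN≤a a<[1+q]N = ℤ.≤-antisym
    (i<1+j⇒i≤j (ℤ.*-cancelʳ-<-nonNeg (+ N) (ℤ.≤-<-trans ([n/ℕd]*d≤n a N) a<[1+q]N)))
    (i<1+j⇒i≤j (ℤ.*-cancelʳ-<-nonNeg (+ N) (ℤ.≤-<-trans qN≤a (n<s[n/ℕd]*d a N))))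

  /ℕ-+-* : ∀ a q → (a ℤ.+ q ℤ.* + N) /ℕ N ≡ a /ℕ N ℤ.+ q
  /ℕ-+-* a q = /ℕ-unique
    (subst (ℤ._≤ a ℤ.+ q ℤ.* + N) (sym (ℤ.*-distribʳ-+ (+ N) (a /ℕ N) q))
      (ℤ.+-monoˡ-≤ (q ℤ.* + N) ([n/ℕd]*d≤n a N)))
    (subst (a ℤ.+ q ℤ.* + N ℤ.<_) (sym (suc-+-* (a /ℕ N) q (+ N)))
      (ℤ.+-monoˡ-< (q ℤ.* + N) (n<s[n/ℕd]*d a N)))

  /ℕ-small : ∀ {k} → k ℕ.< N → + k /ℕ N ≡ + 0
  /ℕ-small k<N = cong +_ (ℕ.m<n⇒m/n≡0 k<N)

  /ℕ-step : ∀ {s t} k → s ℤ.≤ t ℤ.+ + N → (s ℤ.+ k) /ℕ N ℤ.≤ (t ℤ.+ k) /ℕ N ℤ.+ + 1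
  /ℕ-step {s} {t} k s≤t+N = subst ((s ℤ.+ k) /ℕ N ℤ.≤_) (/ℕ-+-* (t ℤ.+ k) (+ 1))
    (/ℕ-mono-≤ (subst (s ℤ.+ k ℤ.≤_) (+-swap-1* t (+ N) k) (ℤ.+-monoˡ-≤ k s≤t+N)))

module _ (m : ℕ) where
  private
    N = suc m

  hermite-ℕ : ∀ r → sumFin {N} (λ k → ι (+ ((r ℕ.+ toℕ k) ℕ./ N))) ≡ ι (+ r)
  hermite-ℕ zero    = trans (sumFin-cong {N} (λ k → cong (ι ∘ +_) (ℕ.m<n⇒m/n≡0 (Fin.toℕ<n k)))) (sumFin-zero {N})
  hermite-ℕ (suc r) = begin
    sumFin {N} (λ k → ι (+ ((suc r ℕ.+ toℕ k) ℕ./ N)))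
      ≡⟨ sumFin-cong {N} (λ k → cong (λ t → ι (+ (t ℕ./ N))) (sym (ℕ.+-suc r (toℕ k)))) ⟩
    Σ₁                                ≡⟨ solve 2 (λ a s → s := a :+ s :- a) refl (g 0) Σ₁ ⟩
    g 0 + Σ₁ - g 0                    ≡⟨ cong (_- g 0) shifted ⟩
    ι (+ r) + (1ℚ + g 0) - g 0        ≡⟨ solve 2 (λ x a → x :+ (con 1ℚ :+ a) :- a := con 1ℚ :+ x) refl (ι (+ r)) (g 0) ⟩
    1ℚ + ι (+ r)                      ≡⟨ ι-+ (+ 1) (+ r) ⟨
    ι (+ suc r)                       ∎
    where
    open ≡-Reasoning
    g : ℕ → ℚ
    g t = ι (+ ((r ℕ.+ t) ℕ./ N))
    Σ₁ = sumFin {N} (λ k → g (suc (toℕ k)))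
    gN : g N ≡ 1ℚ + g 0
    gN = trans (cong (ι ∘ +_) (trans (ℕ.m/n≡1+[m∸n]/n (ℕ.m≤n+m N r))
                 (cong (λ t → 1 ℕ.+ t ℕ./ N) (trans (ℕ.m+n∸n≡m r N) (sym (ℕ.+-identityʳ r))))))
           (ι-+ (+ 1) (+ ((r ℕ.+ 0) ℕ./ N)))
    -- g 0 + Σ₁ is the sum of g over 0, …, N; split off its last term instead of its first.
    shifted : g 0 + Σ₁ ≡ ι (+ r) + (1ℚ + g 0)
    shifted = begin
      g 0 + Σ₁                                             ≡⟨ sumFin-last {N} (g ∘ toℕ) ⟩
      sumFin {N} (g ∘ toℕ ∘ Fin.inject₁) + g (toℕ (Fin.fromℕ N)) ≡⟨ cong₂ _+_ (sumFin-cong {N} (cong g ∘ Fin.toℕ-inject₁)) (cong g (Fin.toℕ-fromℕ N)) ⟩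
      sumFin {N} (g ∘ toℕ) + g N                               ≡⟨ cong₂ _+_ (hermite-ℕ r) gN ⟩
      ι (+ r) + (1ℚ + g 0)                                 ∎

  hermite : ∀ p → sumFin {N} (λ k → ι ((p ℤ.+ + toℕ k) /ℕ N)) ≡ ι p
  hermite p = begin
    sumFin {N} (λ k → ι ((p ℤ.+ + toℕ k) /ℕ N))                          ≡⟨ sumFin-cong {N} term ⟩
    sumFin {N} (λ k → ι (+ ((r ℕ.+ toℕ k) ℕ./ N)) + ι q)                  ≡⟨ sumFin-+ {N} (λ k → ι (+ ((r ℕ.+ toℕ k) ℕ./ N))) (λ _ → ι q) ⟩
    sumFin {N} (λ k → ι (+ ((r ℕ.+ toℕ k) ℕ./ N))) + sumFin {N} (λ _ → ι q) ≡⟨ cong₂ _+_ (hermite-ℕ r) (sumFin-const N (ι q)) ⟩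
    ι (+ r) + ι (+ N) * ι q                                           ≡⟨ cong (_+_ (ι (+ r))) (trans (*-comm (ι (+ N)) (ι q)) (sym (ι-* q (+ N)))) ⟩
    ι (+ r) + ι (q ℤ.* + N)                                           ≡⟨ ι-+ (+ r) (q ℤ.* + N) ⟨
    ι (+ r ℤ.+ q ℤ.* + N)                                             ≡⟨ cong ι (a≡a%ℕn+[a/ℕn]*n p N) ⟨
    ι p                                                               ∎
    where
    open ≡-Reasoning
    r = p %ℕ N
    q = p /ℕ N
    regroup : ∀ k → p ℤ.+ + toℕ k ≡ + (r ℕ.+ toℕ k) ℤ.+ q ℤ.* + N
    regroup k = trans (cong (ℤ._+ + toℕ k) (a≡a%ℕn+[a/ℕn]*n p N))
      (trans (+-swapʳ (+ r) (q ℤ.* + N) (+ toℕ k)) (cong (ℤ._+ q ℤ.* + N) (sym (ℤ.pos-+ r (toℕ k)))))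
    term : ∀ k → ι ((p ℤ.+ + toℕ k) /ℕ N) ≡ ι (+ ((r ℕ.+ toℕ k) ℕ./ N)) + ι q
    term k = trans (cong ι (trans (cong (_/ℕ N) (regroup k)) (/ℕ-+-* N (+ (r ℕ.+ toℕ k)) q)))
      (ι-+ (+ ((r ℕ.+ toℕ k) ℕ./ N)) q)

denominator-cancel : ∀ q → q * ι (+ ↧ₙ q) ≡ ι (↥ q)
denominator-cancel q@(mkℚ a d-1 _) = toℚᵘ-injective (begin-equality
  toℚᵘ (q * ι (+ suc d-1))          ≃⟨ toℚᵘ-homo-* q (ι (+ suc d-1)) ⟩
  toℚᵘ q ℚᵘ.* toℚᵘ (ι (+ suc d-1))  ≃⟨ ℚᵘ.*-cong (ℚᵘ.≃-refl {toℚᵘ q}) (toℚᵘ-ι (+ suc d-1)) ⟩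
  toℚᵘ q ℚᵘ.* ιᵘ (+ suc d-1)        ≃⟨ ℚᵘ.*≡* (trans (ℤ.*-identityʳ (a ℤ.* + suc d-1))
                                         (cong (λ k → a ℤ.* + k) (sym (ℕ.*-identityʳ (suc d-1))))) ⟩
  ιᵘ a                               ≃⟨ toℚᵘ-ι a ⟨
  toℚᵘ (ι a)                         ∎)
  where open ℚᵘ.≤-Reasoning

commonDenominator : ∀ (y : Vecℚ n) → ∃ λ m → ∃ λ (p : Fin n → ℤ) → ∀ i → y i * ι (+ suc m) ≡ ι (p i)
commonDenominator {zero}  y = 0 , (λ ()) , λ ()
-- The new denominator is d (1 + m); since d = ↧ₙ (y zero) is a successor, so is d (1 + m),
-- and suc (pred (d (1 + m))) reduces to it.
commonDenominator {suc n} y with commonDenominator (y ∘ suc)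
... | m , p , yN≡p = ℕ.pred (d ℕ.* suc m) , p′ , yN′≡p′
  where
  open ≡-Reasoning
  d = ↧ₙ (y zero)
  ιN′ : ι (+ (d ℕ.* suc m)) ≡ ι (+ d) * ι (+ suc m)
  ιN′ = trans (cong ι (ℤ.pos-* d (suc m))) (ι-* (+ d) (+ suc m))
  p′ : Fin (suc n) → ℤ
  p′ zero    = ↥ (y zero) ℤ.* + suc m
  p′ (suc i) = p i ℤ.* + d
  yN′≡p′ : ∀ i → y i * ι (+ (d ℕ.* suc m)) ≡ ι (p′ i)
  yN′≡p′ zero = begin
    y zero * ι (+ (d ℕ.* suc m))          ≡⟨ cong (y zero *_) ιN′ ⟩
    y zero * (ι (+ d) * ι (+ suc m))      ≡⟨ *-assoc (y zero) _ _ ⟨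
    y zero * ι (+ d) * ι (+ suc m)        ≡⟨ cong (_* ι (+ suc m)) (denominator-cancel (y zero)) ⟩
    ι (↥ (y zero)) * ι (+ suc m)          ≡⟨ ι-* (↥ (y zero)) (+ suc m) ⟨
    ι (p′ zero)                           ∎
  yN′≡p′ (suc i) = begin
    y (suc i) * ι (+ (d ℕ.* suc m))       ≡⟨ cong (y (suc i) *_) (trans ιN′ (*-comm (ι (+ d)) _)) ⟩
    y (suc i) * (ι (+ suc m) * ι (+ d))   ≡⟨ *-assoc (y (suc i)) _ _ ⟨
    y (suc i) * ι (+ suc m) * ι (+ d)     ≡⟨ cong (_* ι (+ d)) (yN≡p i) ⟩
    ι (p i) * ι (+ d)                     ≡⟨ ι-* (p i) (+ d) ⟨
    ι (p′ (suc i))                        ∎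

-- The polar dual

Dual : List (Arrow n ℓ) → Vecℚ n → Set
Dual arr y = All (λ a → pot y (src a) ≤ pot y (tgt a) + 1ℚ) arr

-1≤q-p⇒p≤q+1 : ∀ {p q} → - 1ℚ ≤ q - p → p ≤ q + 1ℚ
-1≤q-p⇒p≤q+1 {p} {q} -1≤q-p = subst₂ _≤_
  (solve 1 (λ p → :- con 1ℚ :+ (p :+ con 1ℚ) := p) refl p) (solve 2 (λ p q → q :- p :+ (p :+ con 1ℚ) := q :+ con 1ℚ) refl p q)
  (+-monoˡ-≤ (p + 1ℚ) -1≤q-p)

p≤q+1⇒-1≤q-p : ∀ {p q} → p ≤ q + 1ℚ → - 1ℚ ≤ q - p
p≤q+1⇒-1≤q-p {p} {q} p≤q+1 = subst₂ _≤_
  (solve 1 (λ p → p :+ (:- p :- con 1ℚ) := :- con 1ℚ) refl p) (solve 2 (λ p q → q :+ con 1ℚ :+ (:- p :- con 1ℚ) := q :- p) refl p q)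
  (+-monoˡ-≤ (- p - 1ℚ) p≤q+1)

module _ {arr : List (Arrow n ℓ)} where

  PolarDual⇒Dual : ∀ {y} → PolarDual (Root arr) y → Dual arr y
  PolarDual⇒Dual {y} y∈ = All.tabulate λ {a} a∈arr →
    -1≤q-p⇒p≤q+1 {q = pot y (tgt a)} (subst (- 1ℚ ≤_) (dot-rootVec a y) (y∈ (rootVec a) (Root-rootVec a∈arr)))

  Dual⇒PolarDual : ∀ {y} → Dual arr y → PolarDual (Root arr) y
  Dual⇒PolarDual {y} y∈ x x∈ = InConv-dot-≥ (∀-rootVecs (λ v → - 1ℚ ≤ dot v y) λ {a} a∈arr →
    subst (- 1ℚ ≤_) (sym (dot-rootVec a y)) (p≤q+1⇒-1≤q-p {q = pot y (tgt a)} (All.lookup y∈ a∈arr))) x∈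

PolarDual-convex : ∀ {P : Vecℚ n → Set} {vs y} → (∀ {v} → v ∈ vs → PolarDual P v) → InConv vs y → PolarDual P y
PolarDual-convex {y = y} vs⊆P* y∈ x x∈P = subst (- 1ℚ ≤_) (dot-comm y x)
  (InConv-dot-≥ (λ {v} v∈vs → subst (- 1ℚ ≤_) (dot-comm x v) (vs⊆P* v∈vs x x∈P)) y∈)

-- Without starred vertices, Root(Q) is orthogonal to (1, …, 1).
Root-dot-shift : ∀ {arr : List (Arrow n zero)} {x y} w t → Root arr x → y ≐ (w +ᵥ (t ·ᵥ onesV)) → dot x y ≡ dot x w
Root-dot-shift {arr = arr} {x} {y} w t x∈ y≐ = begin
  dot x y                           ≡⟨ dot-congʳ x y≐ ⟩
  dot x (w +ᵥ (t ·ᵥ onesV))         ≡⟨ dot-+ʳ x w (t ·ᵥ onesV) ⟩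
  dot x w + dot x (t ·ᵥ onesV)      ≡⟨ cong (_+_ (dot x w)) (trans (dot-*ʳ x t onesV) (cong (t *_) (dot-onesʳ x))) ⟩
  dot x w + t * sumFin x            ≡⟨ cong (λ s → dot x w + t * s) (Root⇒InSpan {arr = arr} x∈) ⟩
  dot x w + t * 0ℚ                  ≡⟨ solve 2 (λ d t → d :+ t :* con 0ℚ := d) refl (dot x w) t ⟩
  dot x w                           ∎
  where open ≡-Reasoning

potℤ : (Fin n → ℤ) → V̄ n → ℤ
potℤ z (inj₁ i) = z i
potℤ z (inj₂ _) = + 0

pot-embed : ∀ (z : Fin n → ℤ) v → pot (embed z) v ≡ ι (potℤ z v)
pot-embed z (inj₁ i) = refl
pot-embed z (inj₂ _) = refl

potℤ-cong : ∀ {z z′ : Fin n → ℤ} → (∀ i → z i ≡ z′ i) → ∀ v → potℤ z v ≡ potℤ z′ v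
potℤ-cong z≗z′ (inj₁ i) = z≗z′ i
potℤ-cong z≗z′ (inj₂ _) = refl

Dualℤ : List (Arrow n ℓ) → (Fin n → ℤ) → Set
Dualℤ arr z = All (λ a → potℤ z (src a) ℤ.≤ potℤ z (tgt a) ℤ.+ + 1) arr

module _ {arr : List (Arrow n ℓ)} where

  Dualℤ⇒Dual : ∀ {z} → Dualℤ arr z → Dual arr (embed z)
  Dualℤ⇒Dual {z} = All.map λ {a} zs≤zt+1 → subst₂ _≤_ (sym (pot-embed z (src a)))
    (trans (ι-+ (potℤ z (tgt a)) (+ 1)) (cong (_+ 1ℚ) (sym (pot-embed z (tgt a))))) (ι-mono-≤ zs≤zt+1)

  Dualℤ-cong : ∀ {z z′} → (∀ i → z i ≡ z′ i) → Dualℤ arr z → Dualℤ arr z′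
  Dualℤ-cong z≗z′ = All.map λ {a} → subst₂ (λ s t → s ℤ.≤ t ℤ.+ + 1) (potℤ-cong z≗z′ (src a)) (potℤ-cong z≗z′ (tgt a))

  pathLength : ∀ {x y} → Star (EdgeQbar arr) x y → ℕ
  pathLength ε       = 0
  pathLength (_ ◅ p) = suc (pathLength p)

  Dualℤ-path : ∀ {z} → Dualℤ arr z → ∀ {x y} (p : Star (EdgeQbar arr) x y) → potℤ z x ℤ.≤ potℤ z y ℤ.+ + pathLength p
  Dualℤ-path {z} z∈ {x} ε = ℤ.≤-reflexive (sym (ℤ.+-identityʳ (potℤ z x)))
  Dualℤ-path {z} z∈ {y = y} ((a , a∈arr , refl , refl) ◅ p) = ℤ.≤-trans (All.lookup z∈ a∈arr)
    (subst (potℤ z (tgt a) ℤ.+ + 1 ℤ.≤_) (+-1-comm (potℤ z y) (+ pathLength p)) (ℤ.+-monoˡ-≤ (+ 1) (Dualℤ-path z∈ p)))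
    where
    +-1-comm : ∀ a l → a ℤ.+ l ℤ.+ ℤ.1ℤ ≡ a ℤ.+ (ℤ.1ℤ ℤ.+ l)
    +-1-comm = solve-∀

interval : ℕ → ℕ → List ℤ
interval b a = map -[1+_] (upTo b) ++ map (λ k → + k) (upTo (suc a))

∈-interval : ∀ {b a m} → ℤ.- (+ b) ℤ.≤ m → m ℤ.≤ + a → m ∈ interval b a
∈-interval {b} {m = + k}      _         (+≤+ k≤a) = ∈-++⁺ʳ (map -[1+_] (upTo b)) (∈-map⁺ (λ k → + k) (∈-upTo⁺ (s≤s k≤a)))
∈-interval {suc b} {m = -[1+ k ]} (-≤- k≤b) _     = ∈-++⁺ˡ (∈-map⁺ -[1+_] (∈-upTo⁺ (s≤s k≤b)))

0≤i+n⇒-n≤i : ∀ {i} k → + 0 ℤ.≤ i ℤ.+ + k → ℤ.- (+ k) ℤ.≤ i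
0≤i+n⇒-n≤i {i} k 0≤i+k = subst₂ ℤ._≤_ (ℤ.+-identityˡ (ℤ.- (+ k))) (cancel i (+ k)) (ℤ.+-monoˡ-≤ (ℤ.- (+ k)) 0≤i+k)
  where
  cancel : ∀ i k → i ℤ.+ k ℤ.+ ℤ.- k ≡ i
  cancel = solve-∀

vectors : ∀ {A : Set} → (Fin n → List A) → List (Fin n → A)
vectors {zero}  xs = Vector.[] ∷ []
vectors {suc n} xs = cartesianProductWith Vector._∷_ (xs zero) (vectors (xs ∘ suc))

∈-vectors : ∀ {A : Set} (xs : Fin n → List A) {f : Fin n → A} → (∀ i → f i ∈ xs i) → ∃ λ g → g ∈ vectors xs × (∀ i → g i ≡ f i)
∈-vectors {zero}  xs     f∈ = Vector.[] , here refl , λ ()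
∈-vectors {suc n} xs {f} f∈ with ∈-vectors (xs ∘ suc) {f ∘ suc} (f∈ ∘ suc)
... | g , g∈ , g≗f = f zero Vector.∷ g , ∈-cartesianProductWith⁺ Vector._∷_ (f∈ zero) g∈ ,
  λ { zero → refl ; (suc i) → g≗f i }

module _ {y : Vecℚ n} (m : ℕ) {p : Fin n → ℤ}
         (yN≡p : ∀ i → y i * ι (+ suc m) ≡ ι (p i)) where

  pot-scaled : ∀ v → pot y v * ι (+ suc m) ≡ ι (potℤ p v)
  pot-scaled (inj₁ i) = yN≡p i
  pot-scaled (inj₂ _) = *-zeroˡ (ι (+ suc m))

  Dual-scaled : ∀ {arr : List (Arrow n ℓ)} → Dual arr y → All (λ a → potℤ p (src a) ℤ.≤ potℤ p (tgt a) ℤ.+ + suc m) arr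
  Dual-scaled = All.map λ {a} ys≤yt+1 → ι-cancel-≤ (subst₂ _≤_ (pot-scaled (src a))
    (trans (*-distribʳ-+ N (pot y (tgt a)) 1ℚ)
      (trans (cong₂ _+_ (pot-scaled (tgt a)) (*-identityˡ N)) (sym (ι-+ (potℤ p (tgt a)) (+ suc m)))))
    (*-monoʳ-≤-nonNeg N {{nonNegative (ι-mono-≤ {+ 0} {+ suc m} (+≤+ z≤n))}} ys≤yt+1))
    where N = ι (+ suc m)

layer : ∀ m → (Fin n → ℤ) → Fin (suc m) → Fin n → ℤ
layer m p k i = (p i ℤ.+ + toℕ k) /ℕ suc m

potℤ-layer : ∀ m (p : Fin n → ℤ) k v → potℤ (layer m p k) v ≡ (potℤ p v ℤ.+ + toℕ k) /ℕ suc m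
potℤ-layer m p k (inj₁ i) = refl
potℤ-layer m p k (inj₂ _) = sym (/ℕ-small (suc m) (Fin.toℕ<n k))

Dualℤ-layer : ∀ {arr : List (Arrow n ℓ)} m {p} → All (λ a → potℤ p (src a) ℤ.≤ potℤ p (tgt a) ℤ.+ + suc m) arr →
              ∀ k → Dualℤ arr (layer m p k)
Dualℤ-layer m {p} p-dual k = All.map (λ {a} ps≤pt+N →
  subst₂ (λ s t → s ℤ.≤ t ℤ.+ + 1) (sym (potℤ-layer m p k (src a))) (sym (potℤ-layer m p k (tgt a)))
    (/ℕ-step (suc m) {t = potℤ p (tgt a)} (+ toℕ k) ps≤pt+N)) p-dual

module Candidates {arr : List (Arrow (suc n) ℓ)} (sc : StronglyConnected arr) where

  private
    b : Vertex (suc n) ℓ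
    b = baseVertex ℓ

  b̄ : V̄ (suc n)
  b̄ = collapse b

  box : Fin (suc n) → List ℤ
  box i = interval (pathLength (sc b (inj₁ i))) (pathLength (sc (inj₁ i) b))

  Candidate : (Fin (suc n) → ℤ) → Set
  Candidate z = Dualℤ arr z × potℤ z b̄ ≡ + 0

  candidate? : ∀ z → Dec (Candidate z)
  candidate? z = All.all? (λ a → potℤ z (src a) ℤ.≤? potℤ z (tgt a) ℤ.+ + 1) arr ×-dec (potℤ z b̄ ℤ.≟ + 0)

  candidates : List (Fin (suc n) → ℤ)
  candidates = filter candidate? (vectors box)

  candidates-polar : ∀ {y} → y ∈ map embed candidates → PolarDual (Root arr) y
  candidates-polar y∈ with ∈-map⁻ embed y∈
  ... | z , z∈ , refl = Dual⇒PolarDual (Dualℤ⇒Dual (proj₁ (proj₂ (∈-filter⁻ candidate? {xs = vectors box} z∈))))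

  Candidate⇒box : ∀ {z} → Candidate z → ∀ i → z i ∈ box i
  Candidate⇒box {z} (z∈ , zb̄≡0) i = ∈-interval
    (0≤i+n⇒-n≤i _ (subst (ℤ._≤ z i ℤ.+ _) zb̄≡0 (Dualℤ-path z∈ (sc b (inj₁ i)))))
    (subst (z i ℤ.≤_) (trans (cong (ℤ._+ _) zb̄≡0) (ℤ.+-identityˡ _)) (Dualℤ-path z∈ (sc (inj₁ i) b)))

  candidates-complete : ∀ {z} → Candidate z → ∃ λ v → v ∈ candidates × (∀ i → v i ≡ z i)
  candidates-complete {z} z-cand with ∈-vectors box (Candidate⇒box z-cand)
  ... | v , v∈box , v≗z = v ,
    ∈-filter⁺ candidate? v∈box (Dualℤ-cong (sym ∘ v≗z) (proj₁ z-cand) , trans (potℤ-cong v≗z b̄) (proj₂ z-cand)) ,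
    v≗z

  Dual⇒InConv-candidates : ∀ {y} → Dual arr y → pot y b̄ ≡ 0ℚ → InConv (map embed candidates) y
  Dual⇒InConv-candidates {y} y∈ yb̄≡0 = InConv-resp average≐y
    (InConv-average (λ k → embed (proj₁ (lift k))) (λ k → ∈-map⁺ embed (proj₁ (proj₂ (lift k)))))
    where
    m = proj₁ (commonDenominator y)
    p = proj₁ (proj₂ (commonDenominator y))
    yN≡p = proj₂ (proj₂ (commonDenominator y))
    N = suc m
    pb̄≡0 : potℤ p b̄ ≡ + 0
    pb̄≡0 = ι-injective (trans (sym (pot-scaled m yN≡p b̄)) (trans (cong (_* ι (+ N)) yb̄≡0) (*-zeroˡ (ι (+ N)))))
    lift : ∀ k → ∃ λ v → v ∈ candidates × (∀ i → v i ≡ layer m p k i)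
    lift k = candidates-complete (Dualℤ-layer m {p} (Dual-scaled m yN≡p y∈) k ,
      trans (potℤ-layer m p k b̄) (trans (cong (λ w → (w ℤ.+ + toℕ k) /ℕ N) pb̄≡0) (/ℕ-small N (Fin.toℕ<n k))))
    average≐y : (λ i → (+ 1 / N) * sumFin (λ k → embed (proj₁ (lift k)) i)) ≐ y
    average≐y i = begin
      (+ 1 / N) * sumFin (λ k → embed (proj₁ (lift k)) i) ≡⟨ cong ((+ 1 / N) *_) (sumFin-cong (λ k → cong ι (proj₂ (proj₂ (lift k)) i))) ⟩
      (+ 1 / N) * sumFin (λ k → ι (layer m p k i))        ≡⟨ cong ((+ 1 / N) *_) (trans (hermite m (p i)) (sym (yN≡p i))) ⟩
      (+ 1 / N) * (y i * ι (+ N))                          ≡⟨ solve 3 (λ c a n → c :* (a :* n) := a :* (n :* c)) refl (+ 1 / N) (y i) (ι (+ N)) ⟩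
      y i * (ι (+ N) * (+ 1 / N))                          ≡⟨ cong (y i *_) (ι[1+m]*1/[1+m] m) ⟩
      y i * 1ℚ                                             ≡⟨ *-identityʳ (y i) ⟩
      y i                                                  ∎
      where open ≡-Reasoning

dualIsLattice : ∀ {arr : List (Arrow (suc n) ℓ)} → StronglyConnected arr → DualIsLattice ℓ (Root arr)
dualIsLattice {ℓ = suc ℓ} sc = candidates , λ y →
  (λ y∈ → Dual⇒InConv-candidates (PolarDual⇒Dual y∈) refl) , PolarDual-convex candidates-polar
  where open Candidates sc
dualIsLattice {ℓ = zero} {arr = arr} sc = candidates , λ y →
  (λ y∈ → w y , y zero ,
    Dual⇒InConv-candidates (PolarDual⇒Dual λ x x∈ →
      subst (- 1ℚ ≤_) (Root-dot-shift {arr = arr} (w y) (y zero) x∈ (y≐ y)) (y∈ x x∈)) (+-inverseʳ (y zero)) ,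
    y≐ y) ,
  λ w t w∈ y≐w+t x x∈ → subst (- 1ℚ ≤_) (sym (Root-dot-shift {arr = arr} w t x∈ y≐w+t)) (PolarDual-convex candidates-polar w∈ x x∈)
  where
  open Candidates sc
  w : Vecℚ _ → Vecℚ _
  w y i = y i - y zero
  y≐ : ∀ y → y ≐ (w y +ᵥ (y zero ·ᵥ onesV))
  y≐ y i = solve 2 (λ a b → a := a :- b :+ b :* con 1ℚ) refl (y i) (y zero)

theoremA : ∀ (n ℓ : ℕ) (arr : List (Arrow (suc n) ℓ)) →
    IsQuiver (suc n) ℓ arr → StronglyConnected arr → arr ≢ [] →
    OriginInRelInt ℓ (Root arr)
    × DualIsLattice ℓ (Root arr)
    × OnlyLatticePointsOriginAndVertices (Root arr)
theoremA n ℓ []          _ _  []≢[] = ⊥-elim ([]≢[] refl)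
theoremA n ℓ arr@(_ ∷ _) _ sc _     = originInRelInt sc (here refl) , dualIsLattice sc , terminal arr
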